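{- Let $q$ be a power of a prime $p$ and let $d$ be a divisor of $q-1$ with $d>1$ and $\frac{q-1}{d}\le\frac{2p}{3}$. Let $S_d=\{x^d:x\in\mathbb{F}_q^*\}$. If $A,B\subset\mathbb{F}_q$ satisfy $A+B\subset S_d$, then $|A||B|\le\frac{q-1}{d}$. Moreover, if $A+B=S_d$, then $|A||B|=\frac{q-1}{d}$ and all sums $a+b$ ($a\in A$, $b\in B$) are distinct. In particular, if $\frac{q-1}{d}$ is a prime, then there are no $A,B\subset\mathbb{F}_q$ with $|A|,|B|\ge 2$ and $A+B=S_d$.
   Context: $\mathbb{F}_q$ is the finite field with $q$ elements, of characteristic $p$. For sets $A,B\subset\mathbb{F}_q$, $A+B=\{a+b:a\in A,b\in B\}$. -}

module Defs where

open import Level using (0ℓ)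
open import Data.Nat using (ℕ; zero; suc)
open import Data.List using (List; length)
open import Data.List.Membership.Propositional using (_∈_)
open import Data.List.Relation.Unary.Unique.Propositional using (Unique)
open import Data.Product using (Σ; ∃; _×_)
open import Relation.Nullary using (¬_)
open import Relation.Binary.PropositionalEquality using (_≡_; _≢_)
open import Relation.Binary.Definitions using (DecidableEquality)
open import Algebra.Structures using (IsCommutativeRing)

record FiniteField : Set₁ where
  infixl 6 _+_
  infixl 7 _*_
  field
    Carrier : Set
    _+_ _*_ : Carrier → Carrier → Carrier
    -_ : Carrier → Carrier
    0# 1# : Carrier
    isCommutativeRing : IsCommutativeRing _≡_ _+_ _*_ -_ 0# 1#
    _≟_ : DecidableEquality Carrier
    1≢0 : 1# ≢ 0#
    inverse : ∀ x → x ≢ 0# → ∃ λ y → x * y ≡ 1#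
    elements : List Carrier
    elements-unique : Unique elements
    elements-complete : ∀ x → x ∈ elements

  size : ℕ
  size = length elements

  _^_ : Carrier → ℕ → Carrier
  x ^ zero = 1#
  x ^ suc n = x * (x ^ n)

  _·1 : ℕ → Carrier
  zero ·1 = 0#
  suc n ·1 = 1# + (n ·1)

  InS : ℕ → Carrier → Set
  InS d s = Σ Carrier λ x → x ≢ 0# × x ^ d ≡ s

  SumsetSub : List Carrier → List Carrier → ℕ → Set
  SumsetSub A B d = ∀ {a b} → a ∈ A → b ∈ B → InS d (a + b)

  SumsetEq : List Carrier → List Carrier → ℕ → Set
  SumsetEq A B d = SumsetSub A B d
                 × (∀ s → InS d s → Σ Carrier λ a → Σ Carrier λ b → a ∈ A × b ∈ B × a + b ≡ s)

-- Every element of S_d is an m-th root of unity (m = (q - 1)/d), and S_d has at least m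
-- elements because x ↦ x^d is at most d-to-one on F_q^*. Let A + B ⊆ S_d with |A| ≤ |B| and
-- put r = |A| - 1. If m + r < p, choose Lagrange weights with Σ_{a ∈ A} w a · a^e = [e = r]
-- for e ≤ r: then Σ_{a ∈ A} w a (X + a)^(m + r) - 1 has degree m, its X^m coefficient
-- C(m + r, m) is nonzero mod p, and it vanishes to order |A| at every b ∈ B since
-- (a + b)^m = 1. Counting roots with multiplicity gives |A| |B| ≤ m (Stepanov's method).
-- If |A| > p - m, a (p - m)-element part of A still gives (p - m) |B| ≤ m, and with
-- 3m ≤ 2p this leaves only p = 3, m = 2, |A| = |B| = 2, which is excluded by hand.
-- When A + B = S_d, the |A| |B| sums cover at least m elements, so |A| |B| = m and the sums
-- are distinct; for prime m this forces |A| = 1 or |B| = 1.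

module Submission where

open import Defs
open import Level using (0ℓ)
open import Data.Nat as ℕ using (ℕ; zero; suc; z≤n; s≤s; _∸_; _!)
import Data.Nat.Properties as ℕ
open import Data.Nat.Properties using (_!*_!≢0)
open import Data.Nat.Primality using (Prime; composite)
open import Data.Nat.Divisibility using (m∣m*n)
open import Data.Nat.Coprimality using (prime⇒coprime; coprime-Bézout)
open import Data.Nat.GCD using (module Bézout)
open import Data.Nat.Combinatorics using (_C_; k![n∸k]!∣n!; nCk+nC[k+1]≡[n+1]C[k+1]; nCn≡1)
open import Data.Nat.Combinatorics.Specification using (nCk≡n!/k![n-k]!; k>n⇒nCk≡0)
open import Data.Nat.DivMod using (m/n*n≡m)
open import Data.Integer as ℤ using (ℤ; -[1+_]; +[1+_]; sign; ∣_∣; _◃_; _⊖_)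
open import Data.Integer.Properties using ([1+m]⊖[1+n]≡m⊖n)
open import Data.Sign as Sign using (Sign)
open import Data.Maybe as Maybe using (Maybe)
open import Data.Product using (∃; _×_; _,_; proj₁; proj₂; uncurry)
open import Data.Product.Properties using () renaming (≡-dec to ×-≡-dec)
open import Data.Sum using (_⊎_; inj₁; inj₂; [_,_]′)
open import Data.Empty using (⊥; ⊥-elim)
open import Function using (id; _∘_)
open import Data.List using (List; []; _∷_; _++_; length; map; drop; filter; take; cartesianProduct)
open import Data.List.Properties
  using (length-map; length-++; length-take; filter-notAll; filter-all; filter-accept; filter-reject)
open import Data.List.Membership.Propositional using (_∈_; find; lose)
open import Data.List.Membership.Propositional.Properties
  using (∈-filter⁺; ∈-filter⁻; ∈-map⁺; ∈-map⁻; ∈-cartesianProduct⁺)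
open import Data.List.Relation.Unary.Any as Any using (Any; any?; here; there)
open import Data.List.Relation.Unary.All as All using (All; []; _∷_)
open import Data.List.Relation.Unary.All.Properties using (all-filter)
open import Data.List.Relation.Unary.AllPairs using ([]; _∷_)
open import Data.List.Relation.Unary.Unique.Propositional using (Unique)
import Data.List.Relation.Unary.Unique.Propositional.Properties as Unique
open import Data.List.Relation.Binary.Sublist.Propositional.Properties using (Any-resp-⊆)
open import Data.List.Relation.Binary.Sublist.Setoid.Properties using (take-⊆)
open import Relation.Nullary using (¬_; Dec; yes; no)
open import Relation.Nullary.Decidable as Dec using (¬?; _×-dec_; dec⇒maybe)
open import Relation.Unary using (Decidable)
open import Relation.Unary.Properties using (∁?)
open import Relation.Binary.Definitions using (DecidableEquality)
open import Relation.Binary.PropositionalEquality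
open import Relation.Binary.Bundles using (Setoid)
import Relation.Binary.Reasoning.Setoid as SetoidReasoning
open import Algebra.Bundles using (CommutativeRing)
open import Algebra.Structures using (IsCommutativeRing)
open import Algebra.Solver.Ring.AlmostCommutativeRing
  using (AlmostCommutativeRing; fromCommutativeRing; _-Raw-AlmostCommutative⟶_)

module Counting where

  open import Data.Nat using (_+_; _*_; _≤_; _<_)
  open import Data.Nat.Properties using (+-suc; *-suc; +-mono-≤; module ≤-Reasoning)

  module DecEq {A : Set} (_≟_ : DecidableEquality A) where

    _without_ : List A → A → List A
    xs without x = filter (λ y → ¬? (y ≟ x)) xs

    ∈-without⁺ : ∀ {x y xs} → y ∈ xs → y ≢ x → y ∈ xs without x
    ∈-without⁺ = ∈-filter⁺ (λ y → ¬? (y ≟ _))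

    ∈-without⁻ : ∀ {x y xs} → y ∈ xs without x → y ∈ xs × y ≢ x
    ∈-without⁻ = ∈-filter⁻ (λ y → ¬? (y ≟ _))

    without-unique : ∀ {x xs} → Unique xs → Unique (xs without x)
    without-unique = Unique.filter⁺ (λ y → ¬? (y ≟ _))

    length-without< : ∀ {x xs} → x ∈ xs → length (xs without x) < length xs
    length-without< {x} x∈xs = filter-notAll (λ y → ¬? (y ≟ x)) _ (Any.map (λ x≡y y≢x → y≢x (sym x≡y)) x∈xs)

    without-head : ∀ {x xs} → Unique (x ∷ xs) → (x ∷ xs) without x ≡ xs
    without-head {x} {xs} (x∉xs ∷ _) = begin
      (x ∷ xs) without x   ≡⟨ filter-reject (λ y → ¬? (y ≟ x)) (λ x≢x → x≢x refl) ⟩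
      xs without x         ≡⟨ filter-all (λ y → ¬? (y ≟ x)) (All.map (λ x≢y y≡x → x≢y (sym y≡x)) x∉xs) ⟩
      xs                   ∎
      where open ≡-Reasoning

    without-∷ : ∀ {x y xs} → y ≢ x → (y ∷ xs) without x ≡ y ∷ xs without x
    without-∷ {x} = filter-accept (λ z → ¬? (z ≟ x))

    length-without : ∀ {x xs} → Unique xs → x ∈ xs → length xs ≡ suc (length (xs without x))
    length-without xs-unique@(_ ∷ _) (here refl) = cong (suc ∘ length) (sym (without-head xs-unique))
    length-without (y∉xs ∷ xs-unique) (there x∈xs) = trans (cong suc (length-without xs-unique x∈xs))
                                                            (cong (suc ∘ length) (sym (without-∷ (All.lookup y∉xs x∈xs))))

    length-mono-⊆ : ∀ {xs ys} → Unique xs → (∀ {z} → z ∈ xs → z ∈ ys) → length xs ≤ length ys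
    length-mono-⊆ {[]} _ _ = z≤n
    length-mono-⊆ {x ∷ xs} {ys} (x∉xs ∷ xs-unique) xs⊆ys = begin-strict
      length xs             ≤⟨ length-mono-⊆ xs-unique xs⊆ys-x ⟩
      length (ys without x) <⟨ length-without< (xs⊆ys (here refl)) ⟩
      length ys             ∎
      where
        open ≤-Reasoning
        xs⊆ys-x : ∀ {z} → z ∈ xs → z ∈ ys without x
        xs⊆ys-x z∈xs = ∈-without⁺ (xs⊆ys (there z∈xs)) (λ z≡x → All.lookup x∉xs z∈xs (sym z≡x))

  module _ {A B : Set} (_≟A_ : DecidableEquality A) (_≟B_ : DecidableEquality B) (f : A → B) where

    open DecEq _≟A_ using (_without_; ∈-without⁺; length-without<)
    open DecEq _≟B_ using (length-mono-⊆)

    length-<-of-collision : ∀ {xs ys x x′} → Unique ys → (∀ {y} → y ∈ ys → y ∈ map f xs) →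
                            x ∈ xs → x′ ∈ xs → x ≢ x′ → f x ≡ f x′ → length ys < length xs
    length-<-of-collision {xs} {ys} {x} {x′} ys-unique ys⊆fxs x∈xs x′∈xs x≢x′ fx≡fx′ = begin-strict
      length ys                      ≤⟨ length-mono-⊆ ys-unique ys⊆fxs-x ⟩
      length (map f (xs without x))  ≡⟨ length-map f (xs without x) ⟩
      length (xs without x)          <⟨ length-without< {xs = xs} x∈xs ⟩
      length xs                      ∎
      where
        open ≤-Reasoning
        ys⊆fxs-x : ∀ {y} → y ∈ ys → y ∈ map f (xs without x)
        ys⊆fxs-x y∈ys with ∈-map⁻ f (ys⊆fxs y∈ys)
        ... | z , z∈xs , refl with z ≟A x
        ... | yes refl = subst (_∈ map f (xs without x)) (sym fx≡fx′)
                           (∈-map⁺ f (∈-without⁺ x′∈xs (λ x′≡x → x≢x′ (sym x′≡x))))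
        ... | no z≢x = ∈-map⁺ f (∈-without⁺ z∈xs z≢x)

  length-filter+∁ : ∀ {A : Set} {P : A → Set} (P? : Decidable P) xs →
                    length xs ≡ length (filter P? xs) + length (filter (∁? P?) xs)
  length-filter+∁ P? [] = refl
  length-filter+∁ P? (x ∷ xs) with P? x
  ... | yes _ = cong suc (length-filter+∁ P? xs)
  ... | no  _ = trans (cong suc (length-filter+∁ P? xs)) (sym (+-suc _ _))

  module _ {A B : Set} (_≟_ : DecidableEquality B) (f : A → B) {d : ℕ}
           (fibre≤d : ∀ {y zs} → Unique zs → All (λ z → f z ≡ y) zs → length zs ≤ d) where

    length≤bound*length-image : ∀ ys {xs} → Unique xs → (∀ {x} → x ∈ xs → f x ∈ ys) → length xs ≤ d * length ys
    length≤bound*length-image [] {[]} _ _ = z≤n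
    length≤bound*length-image [] {x ∷ _} _ fxs⊆[] with () ← fxs⊆[] (here refl)
    length≤bound*length-image (y ∷ ys) {xs} xs-unique fxs⊆ys = begin
      length xs                                     ≡⟨ length-filter+∁ over-y xs ⟩
      length (filter over-y xs) + length (filter (∁? over-y) xs)
        ≤⟨ +-mono-≤ (fibre≤d (Unique.filter⁺ over-y xs-unique) (all-filter over-y xs))
                    (length≤bound*length-image ys (Unique.filter⁺ (∁? over-y) xs-unique) rest⊆ys) ⟩
      d + d * length ys                             ≡⟨ *-suc d (length ys) ⟨
      d * length (y ∷ ys)                           ∎
      where
        open ≤-Reasoning
        over-y : Decidable (λ x → f x ≡ y)
        over-y x = f x ≟ y
        rest⊆ys : ∀ {x} → x ∈ filter (∁? over-y) xs → f x ∈ ys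
        rest⊆ys x∈rest with ∈-filter⁻ (∁? over-y) x∈rest
        ... | x∈xs , fx≢y with fxs⊆ys x∈xs
        ... | here fx≡y = ⊥-elim (fx≢y fx≡y)
        ... | there fx∈ys = fx∈ys

  length-cartesianProduct : ∀ {A B : Set} (xs : List A) (ys : List B) →
                            length (cartesianProduct xs ys) ≡ length xs * length ys
  length-cartesianProduct [] ys = refl
  length-cartesianProduct (x ∷ xs) ys = begin
    length (map (x ,_) ys ++ cartesianProduct xs ys)   ≡⟨ length-++ (map (x ,_) ys) ⟩
    length (map (x ,_) ys) + length (cartesianProduct xs ys)
      ≡⟨ cong₂ _+_ (length-map (x ,_) ys) (length-cartesianProduct xs ys) ⟩
    length ys + length xs * length ys                ∎
    where open ≡-Reasoning

module NatArithmetic where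

  open import Data.Nat using (_+_; _*_; _≤_; _<_; >-nonZero; n>1⇒nonTrivial)
  open import Data.Nat.Properties
  open ≤-Reasoning

  exponent-drop : ∀ {m r k} → suc m ≤ k → k ≤ m + r → (m + r) ∸ k < r
  exponent-drop {m} {r} {suc k} (s≤s m≤k) 1+k≤m+r = begin-strict
    (m + r) ∸ suc k    <⟨ ∸-monoʳ-< (n<1+n k) 1+k≤m+r ⟩
    (m + r) ∸ k        ≤⟨ ∸-monoʳ-≤ (m + r) m≤k ⟩
    (m + r) ∸ m        ≡⟨ m+n∸m≡n m r ⟩
    r                  ∎

  exceptional-sizes : ∀ {p m a b} → 3 * m ≤ 2 * p → m < p → p ∸ m < a → a ≤ b → (p ∸ m) * b ≤ m →
                      p ≡ 3 × m ≡ 2 × a ≡ 2 × b ≡ 2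
  exceptional-sizes {p} {m} {a} {b} 3m≤2p m<p u<a a≤b ub≤m = p≡3 , m≡2 , a≡2 , b≡2
    where
      u = p ∸ m
      m+u≡p : m + u ≡ p
      m+u≡p = m+[n∸m]≡n (<⇒≤ m<p)
      1≤u : 1 ≤ u
      1≤u = m<n⇒0<n∸m m<p
      m≤2u : m ≤ 2 * u
      m≤2u = +-cancelˡ-≤ (2 * m) m (2 * u) (begin
        2 * m + m         ≡⟨ cong (2 * m +_) (*-identityˡ m) ⟨
        2 * m + 1 * m     ≡⟨ *-distribʳ-+ m 2 1 ⟨
        3 * m             ≤⟨ 3m≤2p ⟩
        2 * p             ≡⟨ cong (2 *_) m+u≡p ⟨
        2 * (m + u)       ≡⟨ *-distribˡ-+ 2 m u ⟩
        2 * m + 2 * u     ∎)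
      b≤2 : b ≤ 2
      b≤2 = *-cancelˡ-≤ u {{>-nonZero 1≤u}} (begin
        u * b   ≤⟨ ub≤m ⟩
        m       ≤⟨ m≤2u ⟩
        2 * u   ≡⟨ *-comm 2 u ⟩
        u * 2   ∎)
      u≡1 : u ≡ 1
      u≡1 = ≤-antisym (≤-pred (≤-trans u<a (≤-trans a≤b b≤2))) 1≤u
      a≡2 : a ≡ 2
      a≡2 = ≤-antisym (≤-trans a≤b b≤2) (subst (_< a) u≡1 u<a)
      b≡2 : b ≡ 2
      b≡2 = ≤-antisym b≤2 (subst (_≤ b) a≡2 a≤b)
      m≡2 : m ≡ 2
      m≡2 = ≤-antisym (subst (λ k → m ≤ 2 * k) u≡1 m≤2u) (subst₂ (λ k l → k * l ≤ m) u≡1 b≡2 ub≤m)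
      p≡3 : p ≡ 3
      p≡3 = trans (sym m+u≡p) (cong₂ _+_ m≡2 u≡1)

  ¬prime-product : ∀ {a b} → 2 ≤ a → 2 ≤ b → ¬ Prime (a * b)
  ¬prime-product {a} {b} 2≤a 2≤b a*b-prime = Prime.notComposite a*b-prime (composite a<a*b (m∣m*n b))
    where
      instance
        _ = n>1⇒nonTrivial 2≤a
        _ = >-nonZero (<-trans (n<1+n 0) 2≤a)
      a<a*b : a < a * b
      a<a*b = m<m*n a b 2≤b

module FieldTheory (F : FiniteField) where

  open FiniteField F
  open NatArithmetic using (exponent-drop; exceptional-sizes; ¬prime-product)

  open IsCommutativeRing isCommutativeRing
    using (+-assoc; +-comm; +-identityˡ; +-identityʳ; -‿inverseʳ;
           *-assoc; *-comm; *-identityˡ; *-identityʳ; zeroˡ; zeroʳ; distribʳ)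

  commutativeRing : CommutativeRing 0ℓ 0ℓ
  commutativeRing = record { isCommutativeRing = isCommutativeRing }

  open import Algebra.Properties.Ring (CommutativeRing.ring commutativeRing)
    using (-0#≈0#; -‿involutive; -‿distribˡ-*; -‿distribʳ-*; -‿+-comm)

  ·1-homo-+ : ∀ m n → (m ℕ.+ n) ·1 ≡ m ·1 + n ·1
  ·1-homo-+ zero    n = sym (+-identityˡ _)
  ·1-homo-+ (suc m) n = trans (cong (1# +_) (·1-homo-+ m n)) (sym (+-assoc _ _ _))

  ·1-homo-* : ∀ m n → (m ℕ.* n) ·1 ≡ m ·1 * n ·1
  ·1-homo-* zero    n = sym (zeroˡ _)
  ·1-homo-* (suc m) n = begin
    (n ℕ.+ m ℕ.* n) ·1       ≡⟨ ·1-homo-+ n (m ℕ.* n) ⟩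
    n ·1 + (m ℕ.* n) ·1      ≡⟨ cong₂ _+_ (sym (*-identityˡ _)) (·1-homo-* m n) ⟩
    1# * n ·1 + m ·1 * n ·1  ≡⟨ distribʳ _ _ _ ⟨
    (1# + m ·1) * n ·1       ∎
    where open ≡-Reasoning

  -- The ring solver needs coefficients with decidable equality; it gets them from ℤ
  -- through the canonical homomorphism ℤ → F.
  private
    signed : Sign → Carrier → Carrier
    signed Sign.+ x = x
    signed Sign.- x = - x

    ⟦_⟧ : ℤ → Carrier
    ⟦ i ⟧ = signed (sign i) (∣ i ∣ ·1)

    ⟦◃⟧ : ∀ s n → ⟦ s ◃ n ⟧ ≡ signed s (n ·1)
    ⟦◃⟧ Sign.+ zero    = refl
    ⟦◃⟧ Sign.+ (suc n) = refl
    ⟦◃⟧ Sign.- zero    = sym -0#≈0#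
    ⟦◃⟧ Sign.- (suc n) = refl

    1+x-[1+y]≡x-y : ∀ x y → (1# + x) + - (1# + y) ≡ x + - y
    1+x-[1+y]≡x-y x y = begin
      (1# + x) + - (1# + y)     ≡⟨ cong ((1# + x) +_) (-‿+-comm 1# y) ⟨
      (1# + x) + (- 1# + - y)   ≡⟨ +-assoc 1# x _ ⟩
      1# + (x + (- 1# + - y))   ≡⟨ cong (1# +_) (+-assoc x (- 1#) (- y)) ⟨
      1# + ((x + - 1#) + - y)   ≡⟨ cong (λ z → 1# + (z + - y)) (+-comm x (- 1#)) ⟩
      1# + ((- 1# + x) + - y)   ≡⟨ cong (1# +_) (+-assoc (- 1#) x (- y)) ⟩
      1# + (- 1# + (x + - y))   ≡⟨ +-assoc 1# (- 1#) _ ⟨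
      (1# + - 1#) + (x + - y)   ≡⟨ cong (_+ (x + - y)) (-‿inverseʳ 1#) ⟩
      0# + (x + - y)            ≡⟨ +-identityˡ _ ⟩
      x + - y                   ∎
      where open ≡-Reasoning

    ⟦⊖⟧ : ∀ m n → ⟦ m ⊖ n ⟧ ≡ m ·1 + - (n ·1)
    ⟦⊖⟧ zero    zero    = sym (trans (cong (0# +_) -0#≈0#) (+-identityʳ _))
    ⟦⊖⟧ zero    (suc n) = sym (+-identityˡ _)
    ⟦⊖⟧ (suc m) zero    = sym (trans (cong (suc m ·1 +_) -0#≈0#) (+-identityʳ _))
    ⟦⊖⟧ (suc m) (suc n) = begin
      ⟦ suc m ⊖ suc n ⟧               ≡⟨ cong ⟦_⟧ ([1+m]⊖[1+n]≡m⊖n m n) ⟩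
      ⟦ m ⊖ n ⟧                       ≡⟨ ⟦⊖⟧ m n ⟩
      m ·1 + - (n ·1)                 ≡⟨ 1+x-[1+y]≡x-y (m ·1) (n ·1) ⟨
      suc m ·1 + - (suc n ·1)         ∎
      where open ≡-Reasoning

    ⟦+⟧ : ∀ i j → ⟦ i ℤ.+ j ⟧ ≡ ⟦ i ⟧ + ⟦ j ⟧
    ⟦+⟧ (ℤ.+ m)    (ℤ.+ n)    = ·1-homo-+ m n
    ⟦+⟧ (ℤ.+ m)    -[1+ n ]   = ⟦⊖⟧ m (suc n)
    ⟦+⟧ -[1+ m ]   (ℤ.+ n)    = trans (⟦⊖⟧ n (suc m)) (+-comm _ _)
    ⟦+⟧ -[1+ m ]   -[1+ n ]   = begin
      - (suc (suc (m ℕ.+ n)) ·1)      ≡⟨ cong (λ k → - (k ·1)) (sym (ℕ.+-suc (suc m) n)) ⟩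
      - ((suc m ℕ.+ suc n) ·1)        ≡⟨ cong -_ (·1-homo-+ (suc m) (suc n)) ⟩
      - (suc m ·1 + suc n ·1)         ≡⟨ -‿+-comm _ _ ⟨
      - (suc m ·1) + - (suc n ·1)     ∎
      where open ≡-Reasoning

    signed-* : ∀ s t x y → signed (s Sign.* t) (x * y) ≡ signed s x * signed t y
    signed-* Sign.+ Sign.+ x y = refl
    signed-* Sign.+ Sign.- x y = -‿distribʳ-* x y
    signed-* Sign.- Sign.+ x y = -‿distribˡ-* x y
    signed-* Sign.- Sign.- x y = begin
      x * y               ≡⟨ -‿involutive (x * y) ⟨
      - - (x * y)         ≡⟨ cong -_ (-‿distribˡ-* x y) ⟩
      - (- x * y)         ≡⟨ -‿distribʳ-* (- x) y ⟩
      - x * - y           ∎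
      where open ≡-Reasoning

    ⟦*⟧ : ∀ i j → ⟦ i ℤ.* j ⟧ ≡ ⟦ i ⟧ * ⟦ j ⟧
    ⟦*⟧ i j = begin
      ⟦ (sign i Sign.* sign j) ◃ ∣ i ∣ ℕ.* ∣ j ∣ ⟧        ≡⟨ ⟦◃⟧ (sign i Sign.* sign j) (∣ i ∣ ℕ.* ∣ j ∣) ⟩
      signed (sign i Sign.* sign j) ((∣ i ∣ ℕ.* ∣ j ∣) ·1)
        ≡⟨ cong (signed (sign i Sign.* sign j)) (·1-homo-* ∣ i ∣ ∣ j ∣) ⟩
      signed (sign i Sign.* sign j) (∣ i ∣ ·1 * ∣ j ∣ ·1)  ≡⟨ signed-* (sign i) (sign j) _ _ ⟩
      ⟦ i ⟧ * ⟦ j ⟧                                       ∎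
      where open ≡-Reasoning

    ⟦-⟧ : ∀ i → ⟦ ℤ.- i ⟧ ≡ - ⟦ i ⟧
    ⟦-⟧ (ℤ.+ zero)  = sym -0#≈0#
    ⟦-⟧ +[1+ n ]    = refl
    ⟦-⟧ -[1+ n ]    = sym (-‿involutive _)

    almostCommutativeRing : AlmostCommutativeRing 0ℓ 0ℓ
    almostCommutativeRing = fromCommutativeRing commutativeRing

    ℤ⟶F : ℤ.+-*-rawRing -Raw-AlmostCommutative⟶ almostCommutativeRing
    ℤ⟶F = record { ⟦_⟧ = ⟦_⟧ ; +-homo = ⟦+⟧ ; *-homo = ⟦*⟧ ; -‿homo = ⟦-⟧
                 ; 0-homo = refl ; 1-homo = +-identityʳ 1# }

    ⟦_⟧≟⟦_⟧ : ∀ i j → Maybe (⟦ i ⟧ ≡ ⟦ j ⟧)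
    ⟦ i ⟧≟⟦ j ⟧ = Maybe.map (cong ⟦_⟧) (dec⇒maybe (i ℤ.≟ j))

  open import Algebra.Solver.Ring ℤ.+-*-rawRing almostCommutativeRing ℤ⟶F ⟦_⟧≟⟦_⟧
    using (solve; _:=_; _:+_; _:*_; :-_)

  ^-distribˡ-+-* : ∀ x m n → x ^ (m ℕ.+ n) ≡ x ^ m * x ^ n
  ^-distribˡ-+-* x zero    n = sym (*-identityˡ _)
  ^-distribˡ-+-* x (suc m) n = trans (cong (x *_) (^-distribˡ-+-* x m n)) (sym (*-assoc _ _ _))

  ^-distribʳ-* : ∀ x y n → (x * y) ^ n ≡ x ^ n * y ^ n
  ^-distribʳ-* x y zero    = sym (*-identityˡ 1#)
  ^-distribʳ-* x y (suc n) = trans (cong (x * y *_) (^-distribʳ-* x y n))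
    (solve 4 (λ x y u v → x :* y :* (u :* v) := x :* u :* (y :* v)) refl x y (x ^ n) (y ^ n))

  1^n≡1 : ∀ n → 1# ^ n ≡ 1#
  1^n≡1 zero    = refl
  1^n≡1 (suc n) = trans (*-identityˡ _) (1^n≡1 n)

  ^-*-assoc : ∀ x m n → (x ^ m) ^ n ≡ x ^ (m ℕ.* n)
  ^-*-assoc x zero    n = 1^n≡1 n
  ^-*-assoc x (suc m) n = begin
    (x * x ^ m) ^ n          ≡⟨ ^-distribʳ-* x (x ^ m) n ⟩
    x ^ n * (x ^ m) ^ n      ≡⟨ cong (x ^ n *_) (^-*-assoc x m n) ⟩
    x ^ n * x ^ (m ℕ.* n)    ≡⟨ ^-distribˡ-+-* x n (m ℕ.* n) ⟨
    x ^ (n ℕ.+ m ℕ.* n)      ∎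
    where open ≡-Reasoning

  -- A total inverse; the value at 0# is junk and never used.
  inv : Carrier → Carrier
  inv x with x ≟ 0#
  ... | yes _ = 0#
  ... | no x≢0 = proj₁ (inverse x x≢0)

  *-inverseʳ : ∀ {x} → x ≢ 0# → x * inv x ≡ 1#
  *-inverseʳ {x} x≢0 with x ≟ 0#
  ... | yes x≡0 = ⊥-elim (x≢0 x≡0)
  ... | no x≢0′ = proj₂ (inverse x x≢0′)

  x*y≡0⇒x≡0⊎y≡0 : ∀ {x y} → x * y ≡ 0# → x ≡ 0# ⊎ y ≡ 0#
  x*y≡0⇒x≡0⊎y≡0 {x} {y} xy≡0 with x ≟ 0#
  ... | yes x≡0 = inj₁ x≡0
  ... | no x≢0 = inj₂ (begin
    y                ≡⟨ *-identityˡ y ⟨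
    1# * y           ≡⟨ cong (_* y) (*-inverseʳ x≢0) ⟨
    x * inv x * y    ≡⟨ solve 3 (λ x i y → x :* i :* y := i :* (x :* y)) refl x (inv x) y ⟩
    inv x * (x * y)  ≡⟨ cong (inv x *_) xy≡0 ⟩
    inv x * 0#       ≡⟨ zeroʳ _ ⟩
    0#               ∎)
    where open ≡-Reasoning

  inv≢0 : ∀ {x} → x ≢ 0# → inv x ≢ 0#
  inv≢0 {x} x≢0 x⁻¹≡0 = 1≢0 (trans (sym (*-inverseʳ x≢0)) (trans (cong (x *_) x⁻¹≡0) (zeroʳ x)))

  *-≢0 : ∀ {x y} → x ≢ 0# → y ≢ 0# → x * y ≢ 0#
  *-≢0 x≢0 y≢0 xy≡0 = [ x≢0 , y≢0 ]′ (x*y≡0⇒x≡0⊎y≡0 xy≡0)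

  x-y≡0⇒x≡y : ∀ {x y} → x + - y ≡ 0# → x ≡ y
  x-y≡0⇒x≡y {x} {y} x-y≡0 = begin
    x                ≡⟨ solve 2 (λ x y → x := (x :+ :- y) :+ y) refl x y ⟩
    (x + - y) + y    ≡⟨ cong (_+ y) x-y≡0 ⟩
    0# + y           ≡⟨ +-identityˡ y ⟩
    y                ∎
    where open ≡-Reasoning

  *-cancelˡ : ∀ {x y z} → x ≢ 0# → x * y ≡ x * z → y ≡ z
  *-cancelˡ {x} {y} {z} x≢0 xy≡xz =
    x-y≡0⇒x≡y ([ (λ x≡0 → ⊥-elim (x≢0 x≡0)) , id ]′ (x*y≡0⇒x≡0⊎y≡0 x[y-z]≡0))
    where
      open ≡-Reasoning
      x[y-z]≡0 : x * (y + - z) ≡ 0#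
      x[y-z]≡0 = begin
        x * (y + - z)        ≡⟨ solve 3 (λ x y z → x :* (y :+ :- z) := x :* y :+ :- (x :* z)) refl x y z ⟩
        x * y + - (x * z)    ≡⟨ cong (λ w → w + - (x * z)) xy≡xz ⟩
        x * z + - (x * z)    ≡⟨ -‿inverseʳ (x * z) ⟩
        0#                   ∎

  ∑ : List Carrier → (Carrier → Carrier) → Carrier
  ∑ []       f = 0#
  ∑ (x ∷ xs) f = f x + ∑ xs f

  syntax ∑ xs (λ x → e) = ∑[ x ∈ xs ] e

  ∑-cong : ∀ xs {f g} → (∀ {x} → x ∈ xs → f x ≡ g x) → ∑ xs f ≡ ∑ xs g
  ∑-cong []       _   = refl
  ∑-cong (x ∷ xs) f≗g = cong₂ _+_ (f≗g (here refl)) (∑-cong xs (f≗g ∘ there))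

  ∑-distrib-+ : ∀ xs f g → ∑[ x ∈ xs ] (f x + g x) ≡ ∑ xs f + ∑ xs g
  ∑-distrib-+ []       f g = sym (+-identityʳ 0#)
  ∑-distrib-+ (x ∷ xs) f g = trans (cong (f x + g x +_) (∑-distrib-+ xs f g))
    (solve 4 (λ a b c d → (a :+ b) :+ (c :+ d) := (a :+ c) :+ (b :+ d)) refl (f x) (g x) (∑ xs f) (∑ xs g))

  ∑-distribʳ-* : ∀ xs f c → ∑[ x ∈ xs ] (f x * c) ≡ ∑ xs f * c
  ∑-distribʳ-* []       f c = sym (zeroˡ c)
  ∑-distribʳ-* (x ∷ xs) f c = trans (cong (f x * c +_) (∑-distribʳ-* xs f c)) (sym (distribʳ c (f x) (∑ xs f)))
  ∑-distribˡ-* : ∀ xs f c → ∑[ x ∈ xs ] (c * f x) ≡ c * ∑ xs f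
  ∑-distribˡ-* xs f c = trans (∑-cong xs λ {x} _ → *-comm c (f x)) (trans (∑-distribʳ-* xs f c) (*-comm _ c))

  module Characteristic {p : ℕ} (p-prime : Prime p) (p·1≡0 : p ·1 ≡ 0#) where

    open ≡-Reasoning

    private
      multiple·1≡0 : ∀ {n} → n ·1 ≡ 0# → ∀ k → (k ℕ.* n) ·1 ≡ 0#
      multiple·1≡0 {n} n·1≡0 k = trans (·1-homo-* k n) (trans (cong (k ·1 *_) n·1≡0) (zeroʳ _))

      1+multiple≢multiple : ∀ {a b} → a ·1 ≡ 0# → b ·1 ≡ 0# → ∀ u v → 1 ℕ.+ u ℕ.* a ≢ v ℕ.* b
      1+multiple≢multiple {a} {b} a·1≡0 b·1≡0 u v 1+ua≡vb = 1≢0 (begin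
        1#                    ≡⟨ +-identityʳ 1# ⟨
        1# + 0#               ≡⟨ cong (1# +_) (multiple·1≡0 a·1≡0 u) ⟨
        (1 ℕ.+ u ℕ.* a) ·1    ≡⟨ cong _·1 1+ua≡vb ⟩
        (v ℕ.* b) ·1          ≡⟨ multiple·1≡0 b·1≡0 v ⟩
        0#                    ∎)

    ·1≢0 : ∀ {j} → 0 ℕ.< j → j ℕ.< p → j ·1 ≢ 0#
    ·1≢0 {suc j} _ j<p j·1≡0 with coprime-Bézout (prime⇒coprime p-prime j<p)
    ... | Bézout.+- x y 1+yj≡xp = 1+multiple≢multiple j·1≡0 p·1≡0 y x 1+yj≡xp
    ... | Bézout.-+ x y 1+xp≡yj = 1+multiple≢multiple p·1≡0 j·1≡0 x y 1+xp≡yj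

    !·1≢0 : ∀ {n} → n ℕ.< p → (n !) ·1 ≢ 0#
    !·1≢0 {zero}  _   = subst (_≢ 0#) (sym (+-identityʳ 1#)) 1≢0
    !·1≢0 {suc n} n<p n!·1≡0 =
      *-≢0 (·1≢0 (s≤s z≤n) n<p) (!·1≢0 (ℕ.<-trans (ℕ.n<1+n n) n<p)) (trans (sym (·1-homo-* (suc n) (n !))) n!·1≡0)

    C·1≢0 : ∀ {n k} → k ℕ.≤ n → n ℕ.< p → (n C k) ·1 ≢ 0#
    C·1≢0 {n} {k} k≤n n<p nCk·1≡0 = !·1≢0 n<p (begin
      (n !) ·1                          ≡⟨ cong _·1 nCk*d≡n! ⟨
      ((n C k) ℕ.* d) ·1                ≡⟨ ·1-homo-* (n C k) d ⟩
      (n C k) ·1 * d ·1                 ≡⟨ cong (_* d ·1) nCk·1≡0 ⟩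
      0# * d ·1                         ≡⟨ zeroˡ _ ⟩
      0#                                ∎)
      where
        d = k ! ℕ.* (n ∸ k) !
        nCk*d≡n! : (n C k) ℕ.* d ≡ n !
        nCk*d≡n! = trans (cong (ℕ._* d) (nCk≡n!/k![n-k]! k≤n)) (m/n*n≡m {{k !* (n ∸ k) !≢0}} (k![n∸k]!∣n! k≤n))

  open Counting.DecEq _≟_
    using (_without_; ∈-without⁺; ∈-without⁻; without-unique; without-head; without-∷; length-without; length-mono-⊆)

  ∏ : List Carrier → Carrier
  ∏ []       = 1#
  ∏ (x ∷ xs) = x * ∏ xs

  ∏-without : ∀ {x ys} → Unique ys → x ∈ ys → ∏ ys ≡ x * ∏ (ys without x)
  ∏-without {x} ys-unique@(_ ∷ _) (here refl) = cong (λ zs → x * ∏ zs) (sym (without-head ys-unique))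
  ∏-without {x} {y ∷ ys} (y∉ys ∷ ys-unique) (there x∈ys) = begin
    y * ∏ ys                         ≡⟨ cong (y *_) (∏-without ys-unique x∈ys) ⟩
    y * (x * ∏ (ys without x))       ≡⟨ solve 3 (λ x y z → y :* (x :* z) := x :* (y :* z)) refl x y (∏ (ys without x)) ⟩
    x * ∏ (y ∷ ys without x)         ≡⟨ cong (λ zs → x * ∏ zs) (without-∷ (All.lookup y∉ys x∈ys)) ⟨
    x * ∏ ((y ∷ ys) without x)       ∎
    where open ≡-Reasoning

  ∏-cong-⊆⊇ : ∀ xs {ys} → Unique xs → Unique ys →
             (∀ {z} → z ∈ xs → z ∈ ys) → (∀ {z} → z ∈ ys → z ∈ xs) → ∏ xs ≡ ∏ ys
  ∏-cong-⊆⊇ []       {[]}    _ _ _ _ = refl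
  ∏-cong-⊆⊇ []       {y ∷ _} _ _ _ ys⊆[] with () ← ys⊆[] (here refl)
  ∏-cong-⊆⊇ (x ∷ xs) {ys} (x∉xs ∷ xs-unique) ys-unique xs⊆ys ys⊆xs = begin
    x * ∏ xs                  ≡⟨ cong (x *_) (∏-cong-⊆⊇ xs xs-unique (without-unique ys-unique) xs⊆ys-x ys-x⊆xs) ⟩
    x * ∏ (ys without x)      ≡⟨ ∏-without ys-unique (xs⊆ys (here refl)) ⟨
    ∏ ys                      ∎
    where
      open ≡-Reasoning
      xs⊆ys-x : ∀ {z} → z ∈ xs → z ∈ ys without x
      xs⊆ys-x z∈xs = ∈-without⁺ (xs⊆ys (there z∈xs)) (λ z≡x → All.lookup x∉xs z∈xs (sym z≡x))
      ys-x⊆xs : ∀ {z} → z ∈ ys without x → z ∈ xs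
      ys-x⊆xs z∈ys-x with ∈-without⁻ z∈ys-x
      ... | z∈ys , z≢x with ys⊆xs z∈ys
      ... | here z≡x   = ⊥-elim (z≢x z≡x)
      ... | there z∈xs = z∈xs

  ∏-map-*ˡ : ∀ x ys → ∏ (map (x *_) ys) ≡ x ^ length ys * ∏ ys
  ∏-map-*ˡ x []       = sym (*-identityˡ 1#)
  ∏-map-*ˡ x (y ∷ ys) = trans (cong (x * y *_) (∏-map-*ˡ x ys))
    (solve 4 (λ x y u v → x :* y :* (u :* v) := x :* u :* (y :* v)) refl x y (x ^ length ys) (∏ ys))

  ∏-≢0 : ∀ ys → (∀ {y} → y ∈ ys → y ≢ 0#) → ∏ ys ≢ 0#
  ∏-≢0 []       _     = 1≢0
  ∏-≢0 (y ∷ ys) ys≢0 = *-≢0 (ys≢0 (here refl)) (∏-≢0 ys (ys≢0 ∘ there))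

  nonzeros : List Carrier
  nonzeros = elements without 0#

  length-nonzeros : length nonzeros ≡ size ∸ 1
  length-nonzeros = sym (cong (_∸ 1) (length-without elements-unique (elements-complete 0#)))

  nonzeros-≢0 : ∀ {x} → x ∈ nonzeros → x ≢ 0#
  nonzeros-≢0 x∈nonzeros = proj₂ (∈-without⁻ {xs = elements} x∈nonzeros)

  2≤size : 2 ℕ.≤ size
  2≤size = length-mono-⊆ {0# ∷ 1# ∷ []} (((λ 0≡1 → 1≢0 (sym 0≡1)) ∷ []) ∷ [] ∷ []) (λ {z} _ → elements-complete z)

  ∈-nonzeros : ∀ {x} → x ≢ 0# → x ∈ nonzeros
  ∈-nonzeros x≢0 = ∈-without⁺ (elements-complete _) x≢0

  -- Multiplication by x permutes the nonzero elements.
  fermat : ∀ {x} → x ≢ 0# → x ^ (size ∸ 1) ≡ 1#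
  fermat {x} x≢0 = *-cancelˡ (∏-≢0 nonzeros nonzeros-≢0) (begin
    ∏ nonzeros * x ^ (size ∸ 1)              ≡⟨ *-comm _ _ ⟩
    x ^ (size ∸ 1) * ∏ nonzeros              ≡⟨ cong (λ n → x ^ n * ∏ nonzeros) length-nonzeros ⟨
    x ^ length nonzeros * ∏ nonzeros         ≡⟨ ∏-map-*ˡ x nonzeros ⟨
    ∏ (map (x *_) nonzeros)
      ≡⟨ ∏-cong-⊆⊇ (map (x *_) nonzeros) xnonzeros-unique (without-unique elements-unique) ⊆ ⊇ ⟩
    ∏ nonzeros                               ≡⟨ *-identityʳ _ ⟨
    ∏ nonzeros * 1#                          ∎)
    where
      open ≡-Reasoning
      xnonzeros-unique : Unique (map (x *_) nonzeros)
      xnonzeros-unique = Unique.map⁺ (*-cancelˡ x≢0) (without-unique elements-unique)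
      ⊆ : ∀ {z} → z ∈ map (x *_) nonzeros → z ∈ nonzeros
      ⊆ z∈ with ∈-map⁻ (x *_) z∈
      ... | y , y∈nonzeros , refl = ∈-nonzeros (*-≢0 x≢0 (nonzeros-≢0 y∈nonzeros))
      ⊇ : ∀ {z} → z ∈ nonzeros → z ∈ map (x *_) nonzeros
      ⊇ {z} z∈nonzeros = subst (_∈ map (x *_) nonzeros) x[x⁻¹z]≡z
        (∈-map⁺ (x *_) (∈-nonzeros (*-≢0 (inv≢0 x≢0) (nonzeros-≢0 z∈nonzeros))))
        where
          x[x⁻¹z]≡z : x * (inv x * z) ≡ z
          x[x⁻¹z]≡z = trans (sym (*-assoc x (inv x) z)) (trans (cong (_* z) (*-inverseʳ x≢0)) (*-identityˡ z))

  -- Polynomials are coefficient lists, constant term first; equality is coefficientwise,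
  -- so trailing zeros do not matter.
  Poly : Set
  Poly = List Carrier

  coeff : Poly → ℕ → Carrier
  coeff []      _       = 0#
  coeff (a ∷ P) zero    = a
  coeff (a ∷ P) (suc k) = coeff P k

  infix 4 _≈_
  record _≈_ (P Q : Poly) : Set where
    constructor mk≈
    field coeff-≈ : ∀ k → coeff P k ≡ coeff Q k
  open _≈_ public

  ≈-refl : ∀ {P} → P ≈ P
  ≈-refl = mk≈ λ _ → refl

  ≈-sym : ∀ {P Q} → P ≈ Q → Q ≈ P
  ≈-sym P≈Q = mk≈ λ k → sym (coeff-≈ P≈Q k)

  ≈-trans : ∀ {P Q R} → P ≈ Q → Q ≈ R → P ≈ R
  ≈-trans P≈Q Q≈R = mk≈ λ k → trans (coeff-≈ P≈Q k) (coeff-≈ Q≈R k)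

  ≈-setoid : Setoid 0ℓ 0ℓ
  ≈-setoid = record
    { Carrier = Poly ; _≈_ = _≈_
    ; isEquivalence = record { refl = ≈-refl ; sym = ≈-sym ; trans = ≈-trans } }

  module ≈-Reasoning = SetoidReasoning ≈-setoid

  infixl 6 _+ₚ_
  _+ₚ_ : Poly → Poly → Poly
  []      +ₚ Q       = Q
  (a ∷ P) +ₚ []      = a ∷ P
  (a ∷ P) +ₚ (b ∷ Q) = a + b ∷ P +ₚ Q

  coeff-+ₚ : ∀ P Q k → coeff (P +ₚ Q) k ≡ coeff P k + coeff Q k
  coeff-+ₚ []      Q       k       = sym (+-identityˡ _)
  coeff-+ₚ (a ∷ P) []      k       = sym (+-identityʳ _)
  coeff-+ₚ (a ∷ P) (b ∷ Q) zero    = refl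
  coeff-+ₚ (a ∷ P) (b ∷ Q) (suc k) = coeff-+ₚ P Q k

  +ₚ-cong : ∀ {P P′ Q Q′} → P ≈ P′ → Q ≈ Q′ → P +ₚ Q ≈ P′ +ₚ Q′
  +ₚ-cong {P} {P′} {Q} {Q′} P≈P′ Q≈Q′ = mk≈ λ k → begin
    coeff (P +ₚ Q) k           ≡⟨ coeff-+ₚ P Q k ⟩
    coeff P k + coeff Q k      ≡⟨ cong₂ _+_ (coeff-≈ P≈P′ k) (coeff-≈ Q≈Q′ k) ⟩
    coeff P′ k + coeff Q′ k    ≡⟨ coeff-+ₚ P′ Q′ k ⟨
    coeff (P′ +ₚ Q′) k         ∎
    where open ≡-Reasoning

  +ₚ-comm : ∀ P Q → P +ₚ Q ≈ Q +ₚ P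
  +ₚ-comm P Q = mk≈ λ k → trans (coeff-+ₚ P Q k) (trans (+-comm _ _) (sym (coeff-+ₚ Q P k)))

  infixr 7 _·ₚ_
  _·ₚ_ : Carrier → Poly → Poly
  c ·ₚ P = map (c *_) P

  coeff-·ₚ : ∀ c P k → coeff (c ·ₚ P) k ≡ c * coeff P k
  coeff-·ₚ c []      k       = sym (zeroʳ c)
  coeff-·ₚ c (a ∷ P) zero    = refl
  coeff-·ₚ c (a ∷ P) (suc k) = coeff-·ₚ c P k

  ·ₚ-cong : ∀ c {P Q} → P ≈ Q → c ·ₚ P ≈ c ·ₚ Q
  ·ₚ-cong c {P} {Q} P≈Q = mk≈ λ k →
    trans (coeff-·ₚ c P k) (trans (cong (c *_) (coeff-≈ P≈Q k)) (sym (coeff-·ₚ c Q k)))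

  const : Carrier → Poly
  const a = a ∷ []

  [X+_]*_ : Carrier → Poly → Poly
  [X+ c ]* P = (0# ∷ P) +ₚ c ·ₚ P

  coeff-[X+]*-zero : ∀ c P → coeff ([X+ c ]* P) 0 ≡ c * coeff P 0
  coeff-[X+]*-zero c P = trans (coeff-+ₚ (0# ∷ P) (c ·ₚ P) 0) (trans (+-identityˡ _) (coeff-·ₚ c P 0))

  coeff-[X+]*-suc : ∀ c P k → coeff ([X+ c ]* P) (suc k) ≡ coeff P k + c * coeff P (suc k)
  coeff-[X+]*-suc c P k = trans (coeff-+ₚ (0# ∷ P) (c ·ₚ P) (suc k)) (cong (coeff P k +_) (coeff-·ₚ c P (suc k)))

  [X+]*-cong : ∀ c {P Q} → P ≈ Q → [X+ c ]* P ≈ [X+ c ]* Q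
  [X+]*-cong c {P} {Q} P≈Q =
    +ₚ-cong {0# ∷ P} {0# ∷ Q} (mk≈ λ { zero → refl ; (suc k) → coeff-≈ P≈Q k }) (·ₚ-cong c P≈Q)

  -- Horner's scheme for P(X + c): (a ∷ P)(X + c) = a + (X + c) · P(X + c).
  private
    horner : Carrier → Carrier → Poly → Poly
    horner c a S = const a +ₚ [X+ c ]* S

  infixl 8 _∘[X+_]
  _∘[X+_] : Poly → Carrier → Poly
  []      ∘[X+ c ] = []
  (a ∷ P) ∘[X+ c ] = horner c a (P ∘[X+ c ])

  private
    x+c*y≡0 : ∀ c {x y} → x ≡ 0# → y ≡ 0# → x + c * y ≡ 0#
    x+c*y≡0 c refl refl = trans (+-identityˡ _) (zeroʳ c)

    coeff-horner-zero : ∀ c a S → coeff (horner c a S) 0 ≡ a + c * coeff S 0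
    coeff-horner-zero c a S = trans (coeff-+ₚ (const a) ([X+ c ]* S) 0) (cong (a +_) (coeff-[X+]*-zero c S))

    coeff-horner-suc : ∀ c a S k → coeff (horner c a S) (suc k) ≡ coeff S k + c * coeff S (suc k)
    coeff-horner-suc c a S k =
      trans (coeff-+ₚ (const a) ([X+ c ]* S) (suc k)) (trans (+-identityˡ _) (coeff-[X+]*-suc c S k))

    horner-cong : ∀ c {a b S T} → a ≡ b → S ≈ T → horner c a S ≈ horner c b T
    horner-cong c {a} refl S≈T = +ₚ-cong {const a} ≈-refl ([X+]*-cong c S≈T)

    horner-≈[] : ∀ c {a S} → a ≡ 0# → S ≈ [] → horner c a S ≈ []
    horner-≈[] c {a} {S} a≡0 S≈[] = mk≈ λ where
      zero    → trans (coeff-horner-zero c a S) (x+c*y≡0 c a≡0 (coeff-≈ S≈[] 0))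
      (suc k) → trans (coeff-horner-suc c a S k) (x+c*y≡0 c (coeff-≈ S≈[] k) (coeff-≈ S≈[] (suc k)))

    horner-+ₚ : ∀ c a b S T → horner c (a + b) (S +ₚ T) ≈ horner c a S +ₚ horner c b T
    horner-+ₚ c a b S T = mk≈ coeffs
      where
        open ≡-Reasoning
        coeffs : ∀ k → coeff (horner c (a + b) (S +ₚ T)) k ≡ coeff (horner c a S +ₚ horner c b T) k
        coeffs zero = begin
          coeff (horner c (a + b) (S +ₚ T)) 0          ≡⟨ coeff-horner-zero c (a + b) (S +ₚ T) ⟩
          (a + b) + c * coeff (S +ₚ T) 0               ≡⟨ cong (λ x → (a + b) + c * x) (coeff-+ₚ S T 0) ⟩
          (a + b) + c * (coeff S 0 + coeff T 0)
            ≡⟨ solve 5 (λ a b c s t → (a :+ b) :+ c :* (s :+ t) := (a :+ c :* s) :+ (b :+ c :* t)) refl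
                       a b c (coeff S 0) (coeff T 0) ⟩
          (a + c * coeff S 0) + (b + c * coeff T 0)    ≡⟨ cong₂ _+_ (coeff-horner-zero c a S) (coeff-horner-zero c b T) ⟨
          coeff (horner c a S) 0 + coeff (horner c b T) 0 ≡⟨ coeff-+ₚ (horner c a S) (horner c b T) 0 ⟨
          coeff (horner c a S +ₚ horner c b T) 0       ∎
        coeffs (suc k) = begin
          coeff (horner c (a + b) (S +ₚ T)) (suc k)    ≡⟨ coeff-horner-suc c (a + b) (S +ₚ T) k ⟩
          coeff (S +ₚ T) k + c * coeff (S +ₚ T) (suc k)
            ≡⟨ cong₂ (λ x y → x + c * y) (coeff-+ₚ S T k) (coeff-+ₚ S T (suc k)) ⟩
          (coeff S k + coeff T k) + c * (coeff S (suc k) + coeff T (suc k))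
            ≡⟨ solve 5 (λ s t c s′ t′ → (s :+ t) :+ c :* (s′ :+ t′) := (s :+ c :* s′) :+ (t :+ c :* t′)) refl
                       (coeff S k) (coeff T k) c (coeff S (suc k)) (coeff T (suc k)) ⟩
          (coeff S k + c * coeff S (suc k)) + (coeff T k + c * coeff T (suc k))
            ≡⟨ cong₂ _+_ (coeff-horner-suc c a S k) (coeff-horner-suc c b T k) ⟨
          coeff (horner c a S) (suc k) + coeff (horner c b T) (suc k)
            ≡⟨ coeff-+ₚ (horner c a S) (horner c b T) (suc k) ⟨
          coeff (horner c a S +ₚ horner c b T) (suc k) ∎

    horner-·ₚ : ∀ c x a S → horner c (x * a) (x ·ₚ S) ≈ x ·ₚ horner c a S
    horner-·ₚ c x a S = mk≈ coeffs
      where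
        open ≡-Reasoning
        coeffs : ∀ k → coeff (horner c (x * a) (x ·ₚ S)) k ≡ coeff (x ·ₚ horner c a S) k
        coeffs zero = begin
          coeff (horner c (x * a) (x ·ₚ S)) 0      ≡⟨ coeff-horner-zero c (x * a) (x ·ₚ S) ⟩
          x * a + c * coeff (x ·ₚ S) 0             ≡⟨ cong (λ y → x * a + c * y) (coeff-·ₚ x S 0) ⟩
          x * a + c * (x * coeff S 0)
            ≡⟨ solve 4 (λ x a c s → x :* a :+ c :* (x :* s) := x :* (a :+ c :* s)) refl x a c (coeff S 0) ⟩
          x * (a + c * coeff S 0)                  ≡⟨ cong (x *_) (coeff-horner-zero c a S) ⟨
          x * coeff (horner c a S) 0               ≡⟨ coeff-·ₚ x (horner c a S) 0 ⟨
          coeff (x ·ₚ horner c a S) 0              ∎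
        coeffs (suc k) = begin
          coeff (horner c (x * a) (x ·ₚ S)) (suc k)  ≡⟨ coeff-horner-suc c (x * a) (x ·ₚ S) k ⟩
          coeff (x ·ₚ S) k + c * coeff (x ·ₚ S) (suc k)
            ≡⟨ cong₂ (λ y z → y + c * z) (coeff-·ₚ x S k) (coeff-·ₚ x S (suc k)) ⟩
          x * coeff S k + c * (x * coeff S (suc k))
            ≡⟨ solve 4 (λ x s c s′ → x :* s :+ c :* (x :* s′) := x :* (s :+ c :* s′)) refl
                       x (coeff S k) c (coeff S (suc k)) ⟩
          x * (coeff S k + c * coeff S (suc k))    ≡⟨ cong (x *_) (coeff-horner-suc c a S k) ⟨
          x * coeff (horner c a S) (suc k)         ≡⟨ coeff-·ₚ x (horner c a S) (suc k) ⟨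
          coeff (x ·ₚ horner c a S) (suc k)        ∎

  coeff-∘-zero : ∀ c a P → coeff ((a ∷ P) ∘[X+ c ]) 0 ≡ a + c * coeff (P ∘[X+ c ]) 0
  coeff-∘-zero c a P = coeff-horner-zero c a (P ∘[X+ c ])

  ∘-≈[] : ∀ c {P} → P ≈ [] → P ∘[X+ c ] ≈ []
  ∘-≈[] c {[]}    _    = ≈-refl
  ∘-≈[] c {a ∷ P} P≈[] =
    horner-≈[] c {S = P ∘[X+ c ]} (coeff-≈ P≈[] 0) (∘-≈[] c {P} (mk≈ λ k → coeff-≈ P≈[] (suc k)))

  ∘-cong : ∀ c {P Q} → P ≈ Q → P ∘[X+ c ] ≈ Q ∘[X+ c ]
  ∘-cong c {[]}    {[]}    _   = ≈-refl
  ∘-cong c {[]}    {b ∷ Q} P≈Q = ≈-sym (∘-≈[] c (≈-sym P≈Q))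
  ∘-cong c {a ∷ P} {[]}    P≈Q = ∘-≈[] c P≈Q
  ∘-cong c {a ∷ P} {b ∷ Q} P≈Q =
    horner-cong c {S = P ∘[X+ c ]} {Q ∘[X+ c ]} (coeff-≈ P≈Q 0) (∘-cong c {P} {Q} (mk≈ λ k → coeff-≈ P≈Q (suc k)))

  ∘-+ₚ : ∀ c P Q → (P +ₚ Q) ∘[X+ c ] ≈ P ∘[X+ c ] +ₚ Q ∘[X+ c ]
  ∘-+ₚ c []      Q       = ≈-refl
  ∘-+ₚ c (a ∷ P) []      = mk≈ λ k → sym (trans (coeff-+ₚ ((a ∷ P) ∘[X+ c ]) [] k) (+-identityʳ _))
  ∘-+ₚ c (a ∷ P) (b ∷ Q) =
    ≈-trans (horner-cong c {S = (P +ₚ Q) ∘[X+ c ]} refl (∘-+ₚ c P Q)) (horner-+ₚ c a b (P ∘[X+ c ]) (Q ∘[X+ c ]))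

  ∘-·ₚ : ∀ c x P → (x ·ₚ P) ∘[X+ c ] ≈ x ·ₚ (P ∘[X+ c ])
  ∘-·ₚ c x []      = ≈-refl
  ∘-·ₚ c x (a ∷ P) =
    ≈-trans (horner-cong c {S = (x ·ₚ P) ∘[X+ c ]} refl (∘-·ₚ c x P)) (horner-·ₚ c x a (P ∘[X+ c ]))

  ∘-const : ∀ c a → const a ∘[X+ c ] ≈ const a
  ∘-const c a = mk≈ λ where
    zero    → trans (coeff-horner-zero c a []) (trans (cong (a +_) (zeroʳ c)) (+-identityʳ a))
    (suc k) → trans (coeff-horner-suc c a [] k) (trans (+-identityˡ _) (zeroʳ c))

  ∘-X* : ∀ c P → (0# ∷ P) ∘[X+ c ] ≈ [X+ c ]* (P ∘[X+ c ])
  ∘-X* c P = mk≈ λ where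
    zero    → trans (coeff-horner-zero c 0# (P ∘[X+ c ]))
                    (trans (+-identityˡ _) (sym (coeff-[X+]*-zero c (P ∘[X+ c ]))))
    (suc k) → trans (coeff-horner-suc c 0# (P ∘[X+ c ]) k) (sym (coeff-[X+]*-suc c (P ∘[X+ c ]) k))

  [X+]*-+-·ₚ : ∀ b c S → [X+ c ]* S +ₚ b ·ₚ S ≈ [X+ b + c ]* S
  [X+]*-+-·ₚ b c S = mk≈ coeffs
    where
      open ≡-Reasoning
      coeffs : ∀ k → coeff ([X+ c ]* S +ₚ b ·ₚ S) k ≡ coeff ([X+ b + c ]* S) k
      coeffs zero = begin
        coeff ([X+ c ]* S +ₚ b ·ₚ S) 0          ≡⟨ coeff-+ₚ ([X+ c ]* S) (b ·ₚ S) 0 ⟩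
        coeff ([X+ c ]* S) 0 + coeff (b ·ₚ S) 0 ≡⟨ cong₂ _+_ (coeff-[X+]*-zero c S) (coeff-·ₚ b S 0) ⟩
        c * coeff S 0 + b * coeff S 0           ≡⟨ solve 3 (λ c b s → c :* s :+ b :* s := (b :+ c) :* s) refl c b (coeff S 0) ⟩
        (b + c) * coeff S 0                     ≡⟨ coeff-[X+]*-zero (b + c) S ⟨
        coeff ([X+ b + c ]* S) 0                ∎
      coeffs (suc k) = begin
        coeff ([X+ c ]* S +ₚ b ·ₚ S) (suc k)                  ≡⟨ coeff-+ₚ ([X+ c ]* S) (b ·ₚ S) (suc k) ⟩
        coeff ([X+ c ]* S) (suc k) + coeff (b ·ₚ S) (suc k)
          ≡⟨ cong₂ _+_ (coeff-[X+]*-suc c S k) (coeff-·ₚ b S (suc k)) ⟩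
        (coeff S k + c * coeff S (suc k)) + b * coeff S (suc k)
          ≡⟨ solve 4 (λ s c b s′ → (s :+ c :* s′) :+ b :* s′ := s :+ (b :+ c) :* s′) refl
                     (coeff S k) c b (coeff S (suc k)) ⟩
        coeff S k + (b + c) * coeff S (suc k)                 ≡⟨ coeff-[X+]*-suc (b + c) S k ⟨
        coeff ([X+ b + c ]* S) (suc k)                        ∎

  ∘-[X+]* : ∀ b c P → ([X+ b ]* P) ∘[X+ c ] ≈ [X+ b + c ]* (P ∘[X+ c ])
  ∘-[X+]* b c P = begin
    ((0# ∷ P) +ₚ b ·ₚ P) ∘[X+ c ]                        ≈⟨ ∘-+ₚ c (0# ∷ P) (b ·ₚ P) ⟩
    (0# ∷ P) ∘[X+ c ] +ₚ (b ·ₚ P) ∘[X+ c ]               ≈⟨ +ₚ-cong (∘-X* c P) (∘-·ₚ c b P) ⟩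
    [X+ c ]* (P ∘[X+ c ]) +ₚ b ·ₚ (P ∘[X+ c ])           ≈⟨ [X+]*-+-·ₚ b c (P ∘[X+ c ]) ⟩
    [X+ b + c ]* (P ∘[X+ c ])                            ∎
    where open ≈-Reasoning

  ∘-∘ : ∀ b c P → P ∘[X+ b ] ∘[X+ c ] ≈ P ∘[X+ b + c ]
  ∘-∘ b c []      = ≈-refl
  ∘-∘ b c (a ∷ P) = begin
    (const a +ₚ [X+ b ]* (P ∘[X+ b ])) ∘[X+ c ]
      ≈⟨ ∘-+ₚ c (const a) ([X+ b ]* (P ∘[X+ b ])) ⟩
    const a ∘[X+ c ] +ₚ ([X+ b ]* (P ∘[X+ b ])) ∘[X+ c ]
      ≈⟨ +ₚ-cong (∘-const c a) (∘-[X+]* b c (P ∘[X+ b ])) ⟩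
    const a +ₚ [X+ b + c ]* (P ∘[X+ b ] ∘[X+ c ])
      ≈⟨ horner-cong (b + c) {S = P ∘[X+ b ] ∘[X+ c ]} refl (∘-∘ b c P) ⟩
    const a +ₚ [X+ b + c ]* (P ∘[X+ b + c ])  ∎
    where open ≈-Reasoning

  ∘-identity : ∀ P → P ∘[X+ 0# ] ≈ P
  ∘-identity []      = ≈-refl
  ∘-identity (a ∷ P) = ≈-trans (horner-cong 0# {S = P ∘[X+ 0# ]} refl (∘-identity P)) (mk≈ λ where
    zero    → trans (coeff-horner-zero 0# a P) (trans (cong (a +_) (zeroˡ _)) (+-identityʳ a))
    (suc k) → trans (coeff-horner-suc 0# a P k) (trans (cong (coeff P k +_) (zeroˡ _)) (+-identityʳ _)))

  ∘-inverse : ∀ c P → P ∘[X+ c ] ∘[X+ - c ] ≈ P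
  ∘-inverse c P = begin
    P ∘[X+ c ] ∘[X+ - c ]   ≈⟨ ∘-∘ c (- c) P ⟩
    P ∘[X+ c + - c ]        ≡⟨ cong (P ∘[X+_]) (-‿inverseʳ c) ⟩
    P ∘[X+ 0# ]             ≈⟨ ∘-identity P ⟩
    P                       ∎
    where open ≈-Reasoning

  eval : Poly → Carrier → Carrier
  eval P a = coeff (P ∘[X+ a ]) 0

  eval-∷ : ∀ p P a → eval (p ∷ P) a ≡ p + a * eval P a
  eval-∷ p P a = coeff-∘-zero a p P

  eval-cong : ∀ {P Q} a → P ≈ Q → eval P a ≡ eval Q a
  eval-cong a P≈Q = coeff-≈ (∘-cong a P≈Q) 0

  eval-+ₚ : ∀ P Q a → eval (P +ₚ Q) a ≡ eval P a + eval Q a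
  eval-+ₚ P Q a = trans (coeff-≈ (∘-+ₚ a P Q) 0) (coeff-+ₚ (P ∘[X+ a ]) (Q ∘[X+ a ]) 0)

  eval-[X+]* : ∀ c Q a → eval ([X+ c ]* Q) a ≡ (c + a) * eval Q a
  eval-[X+]* c Q a = trans (coeff-≈ (∘-[X+]* c a Q) 0) (coeff-[X+]*-zero (c + a) (Q ∘[X+ a ]))

  eval-const : ∀ e a → eval (const e) a ≡ e
  eval-const e a = coeff-≈ (∘-const a e) 0

  eval-∘ : ∀ P b a → eval (P ∘[X+ b ]) a ≡ eval P (b + a)
  eval-∘ P b a = coeff-≈ (∘-∘ b a P) 0

  DegreeBelow : ℕ → Poly → Set
  DegreeBelow n P = ∀ k → n ℕ.≤ k → coeff P k ≡ 0#

  -- VanishesBelow r (P ∘[X+ b ]) says that b is a root of P of multiplicity at least r.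
  VanishesBelow : ℕ → Poly → Set
  VanishesBelow r P = ∀ k → k ℕ.< r → coeff P k ≡ 0#

  Nonzero : Poly → Set
  Nonzero P = ∃ λ k → coeff P k ≢ 0#

  DegreeBelow-mono : ∀ {m n} P → m ℕ.≤ n → DegreeBelow m P → DegreeBelow n P
  DegreeBelow-mono P m≤n deg k n≤k = deg k (ℕ.≤-trans m≤n n≤k)

  VanishesBelow-cong : ∀ {r P Q} → P ≈ Q → VanishesBelow r P → VanishesBelow r Q
  VanishesBelow-cong P≈Q van k k<r = trans (sym (coeff-≈ P≈Q k)) (van k k<r)

  Nonzero-cong : ∀ {P Q} → P ≈ Q → Nonzero P → Nonzero Q
  Nonzero-cong P≈Q (k , Pₖ≢0) = k , λ Qₖ≡0 → Pₖ≢0 (trans (coeff-≈ P≈Q k) Qₖ≡0)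

  nonzero? : ∀ P → Nonzero P ⊎ P ≈ []
  nonzero? [] = inj₂ ≈-refl
  nonzero? (a ∷ P) with a ≟ 0# | nonzero? P
  ... | no a≢0  | _              = inj₁ (0 , a≢0)
  ... | yes _   | inj₁ (k , Pₖ≢0) = inj₁ (suc k , Pₖ≢0)
  ... | yes a≡0 | inj₂ P≈[]       = inj₂ (mk≈ λ { zero → a≡0 ; (suc k) → coeff-≈ P≈[] k })

  DegreeBelow-tail : ∀ {n a P} → DegreeBelow n (a ∷ P) → DegreeBelow (ℕ.pred n) P
  DegreeBelow-tail {zero}  deg k _   = deg (suc k) z≤n
  DegreeBelow-tail {suc n} deg k n≤k = deg (suc k) (s≤s n≤k)

  ∘-degree : ∀ {n} c P → DegreeBelow n P → DegreeBelow n (P ∘[X+ c ])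
  ∘-degree c []      _   _ _ = refl
  ∘-degree {n} c (a ∷ P) deg = λ where
      zero    n≤0   → trans (coeff-horner-zero c a S) (x+c*y≡0 c (deg 0 n≤0) (S-deg 0 (ℕ.pred-mono-≤ n≤0)))
      (suc k) n≤1+k → trans (coeff-horner-suc c a S k)
                            (x+c*y≡0 c (S-deg k (ℕ.pred-mono-≤ n≤1+k))
                                       (S-deg (suc k) (ℕ.pred-mono-≤ (ℕ.m≤n⇒m≤1+n n≤1+k))))
    where
      S = P ∘[X+ c ]
      S-deg : DegreeBelow (ℕ.pred n) S
      S-deg = ∘-degree c P (DegreeBelow-tail {n} deg)

  ∘-nonzero : ∀ c {P} → Nonzero P → Nonzero (P ∘[X+ c ])
  ∘-nonzero c {P} (k , Pₖ≢0) with nonzero? (P ∘[X+ c ])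
  ... | inj₁ nonzero = nonzero
  ... | inj₂ P∘c≈[] = ⊥-elim (Pₖ≢0 (coeff-≈ (≈-trans (≈-sym (∘-inverse c P)) (∘-≈[] (- c) P∘c≈[])) k))

  infixr 8 X^_∙_
  X^_∙_ : ℕ → Poly → Poly
  X^ zero  ∙ Q = Q
  X^ suc r ∙ Q = 0# ∷ X^ r ∙ Q

  coeff-X^∙-< : ∀ {r k} Q → k ℕ.< r → coeff (X^ r ∙ Q) k ≡ 0#
  coeff-X^∙-< {suc r} {zero}  Q _         = refl
  coeff-X^∙-< {suc r} {suc k} Q (s≤s k<r) = coeff-X^∙-< Q k<r

  coeff-X^∙-+ : ∀ r Q k → coeff (X^ r ∙ Q) (r ℕ.+ k) ≡ coeff Q k
  coeff-X^∙-+ zero    Q k = refl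
  coeff-X^∙-+ (suc r) Q k = coeff-X^∙-+ r Q k

  X^∙-nonzero⁻ : ∀ r {Q} → Nonzero (X^ r ∙ Q) → Nonzero Q
  X^∙-nonzero⁻ zero    nonzero             = nonzero
  X^∙-nonzero⁻ (suc r) (zero  , 0≢0)       = ⊥-elim (0≢0 refl)
  X^∙-nonzero⁻ (suc r) (suc k , coeff≢0)   = X^∙-nonzero⁻ r (k , coeff≢0)

  coeff-drop : ∀ r Q k → coeff (drop r Q) k ≡ coeff Q (r ℕ.+ k)
  coeff-drop zero    Q       k = refl
  coeff-drop (suc r) []      k = refl
  coeff-drop (suc r) (q ∷ Q) k = coeff-drop r Q k

  drop-degree : ∀ {n} r Q → DegreeBelow n Q → DegreeBelow (n ∸ r) (drop r Q)
  drop-degree {n} r Q deg k n∸r≤k =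
    trans (coeff-drop r Q k) (deg (r ℕ.+ k) (ℕ.≤-trans (ℕ.m≤n+m∸n n r) (ℕ.+-monoʳ-≤ r n∸r≤k)))

  vanishing⇒≈X^∙drop : ∀ {r Q} → VanishesBelow r Q → Q ≈ X^ r ∙ drop r Q
  vanishing⇒≈X^∙drop {r} {Q} van = mk≈ coeffs
    where
      from-r : ∀ j → coeff Q (r ℕ.+ j) ≡ coeff (X^ r ∙ drop r Q) (r ℕ.+ j)
      from-r j = trans (sym (coeff-drop r Q j)) (sym (coeff-X^∙-+ r (drop r Q) j))
      coeffs : ∀ k → coeff Q k ≡ coeff (X^ r ∙ drop r Q) k
      coeffs k with k ℕ.<? r
      ... | yes k<r = trans (van k k<r) (sym (coeff-X^∙-< (drop r Q) k<r))
      ... | no  k≮r =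
        subst (λ i → coeff Q i ≡ coeff (X^ r ∙ drop r Q) i) (ℕ.m+[n∸m]≡n (ℕ.≮⇒≥ k≮r)) (from-r (k ∸ r))

  [X+_]^_*_ : Carrier → ℕ → Poly → Poly
  [X+ c ]^ zero  * W = W
  [X+ c ]^ suc r * W = [X+ c ]* ([X+ c ]^ r * W)

  ∘-X^∙ : ∀ c r Q → (X^ r ∙ Q) ∘[X+ c ] ≈ [X+ c ]^ r * (Q ∘[X+ c ])
  ∘-X^∙ c zero    Q = ≈-refl
  ∘-X^∙ c (suc r) Q = ≈-trans (∘-X* c (X^ r ∙ Q)) ([X+]*-cong c (∘-X^∙ c r Q))

  vanishing-[X+]*⁻ : ∀ {c n} W → c ≢ 0# → VanishesBelow n ([X+ c ]* W) → VanishesBelow n W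
  vanishing-[X+]*⁻ {c} {n} W c≢0 van = go
    where
      cancel : ∀ {x} → c * x ≡ 0# → x ≡ 0#
      cancel cx≡0 = [ (λ c≡0 → ⊥-elim (c≢0 c≡0)) , id ]′ (x*y≡0⇒x≡0⊎y≡0 cx≡0)
      go : VanishesBelow n W
      go zero    0<n   = cancel (trans (sym (coeff-[X+]*-zero c W)) (van 0 0<n))
      go (suc k) 1+k<n = cancel (begin
        c * coeff W (suc k)                  ≡⟨ +-identityˡ _ ⟨
        0# + c * coeff W (suc k)             ≡⟨ cong (_+ c * coeff W (suc k)) (go k (ℕ.<-trans (ℕ.n<1+n k) 1+k<n)) ⟨
        coeff W k + c * coeff W (suc k)      ≡⟨ coeff-[X+]*-suc c W k ⟨
        coeff ([X+ c ]* W) (suc k)           ≡⟨ van (suc k) 1+k<n ⟩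
        0#                                   ∎)
        where open ≡-Reasoning

  vanishing-[X+]^*⁻ : ∀ {c n} r W → c ≢ 0# → VanishesBelow n ([X+ c ]^ r * W) → VanishesBelow n W
  vanishing-[X+]^*⁻ zero    W c≢0 van = van
  vanishing-[X+]^*⁻ {c} (suc r) W c≢0 van = vanishing-[X+]^*⁻ r W c≢0 (vanishing-[X+]*⁻ ([X+ c ]^ r * W) c≢0 van)

  -- If b is a root of order r of P, then P = (X - b)^r · deflate r b P.
  deflate : ℕ → Carrier → Poly → Poly
  deflate r b P = drop r (P ∘[X+ b ]) ∘[X+ - b ]

  deflate-degree : ∀ {n} r b P → DegreeBelow n P → DegreeBelow (n ∸ r) (deflate r b P)
  deflate-degree r b P deg = ∘-degree (- b) (drop r (P ∘[X+ b ])) (drop-degree r (P ∘[X+ b ]) (∘-degree b P deg))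

  deflate-nonzero : ∀ {r b} P → VanishesBelow r (P ∘[X+ b ]) → Nonzero P → Nonzero (deflate r b P)
  deflate-nonzero {r} {b} P van P≢0 = ∘-nonzero (- b) {drop r (P ∘[X+ b ])}
    (X^∙-nonzero⁻ r (Nonzero-cong (vanishing⇒≈X^∙drop van) (∘-nonzero b {P} P≢0)))

  deflate-root : ∀ {r b b′} P → b′ ≢ b → VanishesBelow r (P ∘[X+ b ]) → VanishesBelow r (P ∘[X+ b′ ]) →
                 VanishesBelow r (deflate r b P ∘[X+ b′ ])
  deflate-root {r} {b} {b′} P b′≢b van van′ = VanishesBelow-cong (≈-sym (∘-∘ (- b) b′ Q))
    (vanishing-[X+]^*⁻ r (Q ∘[X+ c ]) c≢0 (VanishesBelow-cong P∘b′≈ van′))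
    where
      open ≈-Reasoning
      Q = drop r (P ∘[X+ b ])
      c = - b + b′
      c≢0 : c ≢ 0#
      c≢0 c≡0 = b′≢b (x-y≡0⇒x≡y (trans (+-comm b′ (- b)) c≡0))
      P∘b′≈ : P ∘[X+ b′ ] ≈ [X+ c ]^ r * (Q ∘[X+ c ])
      P∘b′≈ = begin
        P ∘[X+ b′ ]              ≡⟨ cong (P ∘[X+_]) (solve 2 (λ b b′ → b′ := b :+ (:- b :+ b′)) refl b b′) ⟩
        P ∘[X+ b + c ]           ≈⟨ ∘-∘ b c P ⟨
        P ∘[X+ b ] ∘[X+ c ]      ≈⟨ ∘-cong c (vanishing⇒≈X^∙drop van) ⟩
        (X^ r ∙ Q) ∘[X+ c ]      ≈⟨ ∘-X^∙ c r Q ⟩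
        [X+ c ]^ r * (Q ∘[X+ c ]) ∎

  root-order≤degree : ∀ {r D} Q → VanishesBelow r Q → Nonzero Q → DegreeBelow (suc D) Q → r ℕ.≤ D
  root-order≤degree {r} {D} Q van (k , Qₖ≢0) deg = ℕ.≤-trans r≤k k≤D
    where
      r≤k : r ℕ.≤ k
      r≤k = ℕ.≮⇒≥ λ k<r → Qₖ≢0 (van k k<r)
      k≤D : k ℕ.≤ D
      k≤D = ℕ.≤-pred (ℕ.≰⇒> λ D+1≤k → Qₖ≢0 (deg k D+1≤k))

  root-count : ∀ {r D} bs P → Unique bs → Nonzero P → DegreeBelow (suc D) P →
               (∀ {b} → b ∈ bs → VanishesBelow r (P ∘[X+ b ])) → r ℕ.* length bs ℕ.≤ D
  root-count {r} {D} []       P _ _ _ _ = subst (ℕ._≤ D) (sym (ℕ.*-zeroʳ r)) z≤n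
  root-count {r} {D} (b ∷ bs) P (b∉bs ∷ bs-unique) P≢0 deg roots = begin
    r ℕ.* suc (length bs)    ≡⟨ ℕ.*-suc r (length bs) ⟩
    r ℕ.+ r ℕ.* length bs    ≤⟨ ℕ.+-monoʳ-≤ r bs-count ⟩
    r ℕ.+ (D ∸ r)            ≡⟨ ℕ.m+[n∸m]≡n r≤D ⟩
    D                        ∎
    where
      open ℕ.≤-Reasoning
      b-root = roots (here refl)
      r≤D : r ℕ.≤ D
      r≤D = root-order≤degree (P ∘[X+ b ]) b-root (∘-nonzero b {P} P≢0) (∘-degree b P deg)
      bs-count : r ℕ.* length bs ℕ.≤ D ∸ r
      bs-count = root-count bs (deflate r b P) bs-unique (deflate-nonzero P b-root P≢0)
        (subst (λ n → DegreeBelow n (deflate r b P)) (ℕ.+-∸-assoc 1 r≤D) (deflate-degree r b P deg))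
        (λ b′∈bs → deflate-root P (λ b′≡b → All.lookup b∉bs b′∈bs (sym b′≡b)) b-root (roots (there b′∈bs)))

  private
    horner-split : ∀ c R → R ∘[X+ c ] ≈ [X+ c ]* (drop 1 R ∘[X+ c ]) +ₚ const (coeff R 0)
    horner-split c []      = mk≈ λ { zero → sym (+-identityˡ 0#) ; (suc k) → refl }
    horner-split c (e ∷ R) = +ₚ-comm (const e) ([X+ c ]* (R ∘[X+ c ]))

  factor-theorem : ∀ a P → P ≈ [X+ - a ]* deflate 1 a P +ₚ const (eval P a)
  factor-theorem a P = ≈-trans (≈-sym (∘-inverse a P)) (horner-split (- a) (P ∘[X+ a ]))

  eval-factored : ∀ a Q e x → eval ([X+ - a ]* Q +ₚ const e) x ≡ (- a + x) * eval Q x + e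
  eval-factored a Q e x = trans (eval-+ₚ ([X+ - a ]* Q) (const e) x) (cong₂ _+_ (eval-[X+]* (- a) Q x) (eval-const e x))

  coeff-factored-suc : ∀ a Q e k → coeff ([X+ - a ]* Q +ₚ const e) (suc k) ≡ coeff Q k + - a * coeff Q (suc k)
  coeff-factored-suc a Q e k =
    trans (coeff-+ₚ ([X+ - a ]* Q) (const e) (suc k)) (trans (+-identityʳ _) (coeff-[X+]*-suc (- a) Q k))

  eval-degree<1 : ∀ P a → DegreeBelow 1 P → eval P a ≡ coeff P 0
  eval-degree<1 []      a _   = refl
  eval-degree<1 (p ∷ P) a deg = begin
    eval (p ∷ P) a     ≡⟨ eval-∷ p P a ⟩
    p + a * eval P a   ≡⟨ cong (λ x → p + a * x) (∘-degree a P (DegreeBelow-tail {1} deg) 0 z≤n) ⟩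
    p + a * 0#         ≡⟨ cong (p +_) (zeroʳ a) ⟩
    p + 0#             ≡⟨ +-identityʳ p ⟩
    p                  ∎
    where open ≡-Reasoning

  coeff-quotient : ∀ {n} a P → DegreeBelow (suc (suc n)) P → coeff (deflate 1 a P) n ≡ coeff P (suc n)
  coeff-quotient {n} a P deg = sym (begin
    coeff P (suc n)                                  ≡⟨ coeff-≈ (factor-theorem a P) (suc n) ⟩
    coeff ([X+ - a ]* Q +ₚ const (eval P a)) (suc n) ≡⟨ coeff-factored-suc a Q (eval P a) n ⟩
    coeff Q n + - a * coeff Q (suc n)
      ≡⟨ cong (λ y → coeff Q n + - a * y) (deflate-degree 1 a P deg (suc n) ℕ.≤-refl) ⟩
    coeff Q n + - a * 0#                             ≡⟨ cong (coeff Q n +_) (zeroʳ _) ⟩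
    coeff Q n + 0#                                   ≡⟨ +-identityʳ _ ⟩
    coeff Q n                                        ∎)
    where
      open ≡-Reasoning
      Q = deflate 1 a P

  eval-quotient : ∀ {a x} P → x ≢ a → eval P x * inv (x + - a) ≡ eval (deflate 1 a P) x + eval P a * inv (x + - a)
  eval-quotient {a} {x} P x≢a = begin
    eval P x * i                        ≡⟨ cong (_* i) (trans (eval-cong x (factor-theorem a P)) (eval-factored a Q e x)) ⟩
    ((- a + x) * eval Q x + e) * i
      ≡⟨ solve 5 (λ a x q e i → ((:- a :+ x) :* q :+ e) :* i := q :* ((x :+ :- a) :* i) :+ e :* i)
                 refl a x (eval Q x) e i ⟩
    eval Q x * ((x + - a) * i) + e * i  ≡⟨ cong (λ y → eval Q x * y + e * i) (*-inverseʳ (x≢a ∘ x-y≡0⇒x≡y)) ⟩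
    eval Q x * 1# + e * i               ≡⟨ cong (_+ e * i) (*-identityʳ _) ⟩
    eval Q x + e * i                    ∎
    where
      open ≡-Reasoning
      Q = deflate 1 a P
      e = eval P a
      i = inv (x + - a)

  -- Lagrange weights, built by induction on A: after dividing P by X - a, the weights of the
  -- rest of A, scaled by (x - a)⁻¹, read off the top coefficient of the quotient.
  interpolation-weights : ∀ A {n} → Unique A → length A ≡ suc n → ∃ λ (w : Carrier → Carrier) →
                          ∀ P → DegreeBelow (suc n) P → ∑[ a ∈ A ] (w a * eval P a) ≡ coeff P n
  interpolation-weights (a ∷ []) {zero} _ _ = (λ _ → 1#) , λ P deg → begin
    1# * eval P a + 0#    ≡⟨ +-identityʳ _ ⟩
    1# * eval P a         ≡⟨ *-identityˡ _ ⟩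
    eval P a              ≡⟨ eval-degree<1 P a deg ⟩
    coeff P 0             ∎
    where open ≡-Reasoning
  interpolation-weights (a ∷ A@(_ ∷ _)) {suc n} (a∉A ∷ A-unique) |A|≡ = w , spec
    where
      open ≡-Reasoning
      IH = interpolation-weights A A-unique (ℕ.suc-injective |A|≡)
      w′ = proj₁ IH
      v : Carrier → Carrier
      v x = w′ x * inv (x + - a)
      w : Carrier → Carrier
      w x with x ≟ a
      ... | yes _ = - ∑[ y ∈ A ] v y
      ... | no  _ = v x
      w-a : w a ≡ - ∑[ y ∈ A ] v y
      w-a with a ≟ a
      ... | yes _   = refl
      ... | no  a≢a = ⊥-elim (a≢a refl)
      w-A : ∀ {x} → x ∈ A → w x ≡ v x
      w-A {x} x∈A with x ≟ a
      ... | yes refl = ⊥-elim (All.lookup a∉A x∈A refl)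
      ... | no  _    = refl
      spec : ∀ P → DegreeBelow (suc (suc n)) P → ∑[ x ∈ a ∷ A ] (w x * eval P x) ≡ coeff P (suc n)
      spec P deg = begin
        w a * e + ∑[ x ∈ A ] (w x * eval P x)
          ≡⟨ cong₂ (λ s t → s * e + t) w-a (∑-cong A term) ⟩
        - V * e + ∑[ x ∈ A ] (w′ x * eval Q x + v x * e)
          ≡⟨ cong (- V * e +_) (trans (∑-distrib-+ A _ _)
                                      (cong (∑[ x ∈ A ] (w′ x * eval Q x) +_) (∑-distribʳ-* A v e))) ⟩
        - V * e + (∑[ x ∈ A ] (w′ x * eval Q x) + V * e)
          ≡⟨ solve 3 (λ V e s → :- V :* e :+ (s :+ V :* e) := s) refl V e _ ⟩
        ∑[ x ∈ A ] (w′ x * eval Q x)  ≡⟨ proj₂ IH Q (deflate-degree 1 a P deg) ⟩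
        coeff Q n                     ≡⟨ coeff-quotient a P deg ⟩
        coeff P (suc n)               ∎
        where
          Q = deflate 1 a P
          e = eval P a
          V = ∑[ y ∈ A ] v y
          term : ∀ {x} → x ∈ A → w x * eval P x ≡ w′ x * eval Q x + v x * e
          term {x} x∈A = begin
            w x * eval P x                        ≡⟨ cong (_* eval P x) (w-A x∈A) ⟩
            w′ x * i * eval P x                   ≡⟨ *-assoc (w′ x) i (eval P x) ⟩
            w′ x * (i * eval P x)                 ≡⟨ cong (w′ x *_) (*-comm i (eval P x)) ⟩
            w′ x * (eval P x * i)                 ≡⟨ cong (w′ x *_) (eval-quotient P x≢a) ⟩
            w′ x * (eval Q x + e * i)
              ≡⟨ solve 4 (λ w q e i → w :* (q :+ e :* i) := w :* q :+ w :* i :* e) refl (w′ x) (eval Q x) e i ⟩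
            w′ x * eval Q x + v x * e             ∎
            where
              i = inv (x + - a)
              x≢a : x ≢ a
              x≢a x≡a = All.lookup a∉A x∈A (sym x≡a)

  X^_ : ℕ → Poly
  X^ N = X^ N ∙ const 1#

  X^-degree : ∀ N → DegreeBelow (suc N) (X^ N)
  X^-degree N k N<k = begin
    coeff (X^ N) k                      ≡⟨ cong (coeff (X^ N)) (ℕ.m+[n∸m]≡n (ℕ.<⇒≤ N<k)) ⟨
    coeff (X^ N) (N ℕ.+ (k ∸ N))        ≡⟨ coeff-X^∙-+ N (const 1#) (k ∸ N) ⟩
    coeff (const 1#) (k ∸ N)            ≡⟨ coeff-const-suc (ℕ.m<n⇒0<n∸m N<k) ⟩
    0#                                  ∎
    where
      open ≡-Reasoning
      coeff-const-suc : ∀ {j} → 0 ℕ.< j → coeff (const 1#) j ≡ 0#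
      coeff-const-suc {suc j} _ = refl

  coeff-X^-self : ∀ N → coeff (X^ N) N ≡ 1#
  coeff-X^-self N = trans (cong (coeff (X^ N)) (sym (ℕ.+-identityʳ N))) (coeff-X^∙-+ N (const 1#) 0)

  private
    C-suc·c^ : ∀ N j c → (N C suc j) ·1 * (c * c ^ (N ∸ suc j)) ≡ (N C suc j) ·1 * c ^ (N ∸ j)
    C-suc·c^ N j c with j ℕ.<? N
    ... | yes j<N = cong (λ e → (N C suc j) ·1 * c ^ e) (sym (ℕ.+-∸-assoc 1 j<N))
    ... | no  j≮N = begin
      (N C suc j) ·1 * (c * c ^ (N ∸ suc j))   ≡⟨ cong (λ n → n ·1 * (c * c ^ (N ∸ suc j))) N<1+j⇒C≡0 ⟩
      0# * (c * c ^ (N ∸ suc j))               ≡⟨ zeroˡ _ ⟩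
      0#                                       ≡⟨ zeroˡ _ ⟨
      0# * c ^ (N ∸ j)                         ≡⟨ cong (λ n → n ·1 * c ^ (N ∸ j)) N<1+j⇒C≡0 ⟨
      (N C suc j) ·1 * c ^ (N ∸ j)             ∎
      where
        open ≡-Reasoning
        N<1+j⇒C≡0 : N C suc j ≡ 0
        N<1+j⇒C≡0 = k>n⇒nCk≡0 (s≤s (ℕ.≮⇒≥ j≮N))

  coeff-X^-∘ : ∀ c N j → coeff (X^ N ∘[X+ c ]) j ≡ (N C j) ·1 * c ^ (N ∸ j)
  coeff-X^-∘ c zero zero = begin
    coeff (const 1# ∘[X+ c ]) 0    ≡⟨ coeff-≈ (∘-const c 1#) 0 ⟩
    1#                             ≡⟨ *-identityʳ 1# ⟨
    1# * 1#                        ≡⟨ cong (_* 1#) (+-identityʳ 1#) ⟨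
    (0 C 0) ·1 * c ^ 0             ∎
    where open ≡-Reasoning
  coeff-X^-∘ c zero (suc j) = trans (coeff-≈ (∘-const c 1#) (suc j)) (sym (zeroˡ _))
  coeff-X^-∘ c (suc N) zero = begin
    coeff ((0# ∷ X^ N) ∘[X+ c ]) 0        ≡⟨ coeff-≈ (∘-X* c (X^ N)) 0 ⟩
    coeff ([X+ c ]* (X^ N ∘[X+ c ])) 0    ≡⟨ coeff-[X+]*-zero c (X^ N ∘[X+ c ]) ⟩
    c * coeff (X^ N ∘[X+ c ]) 0           ≡⟨ cong (c *_) (coeff-X^-∘ c N 0) ⟩
    c * ((N C 0) ·1 * c ^ N)              ≡⟨ solve 3 (λ c u v → c :* (u :* v) := u :* (c :* v)) refl c (1 ·1) (c ^ N) ⟩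
    (suc N C 0) ·1 * (c * c ^ N)          ∎
    where open ≡-Reasoning
  coeff-X^-∘ c (suc N) (suc j) = begin
    coeff ((0# ∷ X^ N) ∘[X+ c ]) (suc j)                ≡⟨ coeff-≈ (∘-X* c (X^ N)) (suc j) ⟩
    coeff ([X+ c ]* (X^ N ∘[X+ c ])) (suc j)            ≡⟨ coeff-[X+]*-suc c (X^ N ∘[X+ c ]) j ⟩
    coeff (X^ N ∘[X+ c ]) j + c * coeff (X^ N ∘[X+ c ]) (suc j)
      ≡⟨ cong₂ (λ x y → x + c * y) (coeff-X^-∘ c N j) (coeff-X^-∘ c N (suc j)) ⟩
    (N C j) ·1 * c ^ (N ∸ j) + c * ((N C suc j) ·1 * c ^ (N ∸ suc j))
      ≡⟨ cong ((N C j) ·1 * c ^ (N ∸ j) +_)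
              (trans (solve 3 (λ c u v → c :* (u :* v) := u :* (c :* v)) refl c _ _) (C-suc·c^ N j c)) ⟩
    (N C j) ·1 * c ^ (N ∸ j) + (N C suc j) ·1 * c ^ (N ∸ j)
      ≡⟨ distribʳ (c ^ (N ∸ j)) _ _ ⟨
    ((N C j) ·1 + (N C suc j) ·1) * c ^ (N ∸ j)
      ≡⟨ cong (_* c ^ (N ∸ j)) (trans (sym (·1-homo-+ (N C j) (N C suc j))) (cong _·1 (nCk+nC[k+1]≡[n+1]C[k+1] N j))) ⟩
    (suc N C suc j) ·1 * c ^ (N ∸ j)                    ∎
    where open ≡-Reasoning

  eval-X^ : ∀ N a → eval (X^ N) a ≡ a ^ N
  eval-X^ N a = trans (coeff-X^-∘ a N 0) (trans (cong (_* a ^ N) (+-identityʳ 1#)) (*-identityˡ _))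

  ∑ₚ : List Carrier → (Carrier → Poly) → Poly
  ∑ₚ []       f = []
  ∑ₚ (x ∷ xs) f = f x +ₚ ∑ₚ xs f

  coeff-∑ₚ : ∀ xs f k → coeff (∑ₚ xs f) k ≡ ∑[ x ∈ xs ] coeff (f x) k
  coeff-∑ₚ []       f k = refl
  coeff-∑ₚ (x ∷ xs) f k = trans (coeff-+ₚ (f x) (∑ₚ xs f) k) (cong (coeff (f x) k +_) (coeff-∑ₚ xs f k))

  ∘-∑ₚ : ∀ c xs f → ∑ₚ xs f ∘[X+ c ] ≈ ∑ₚ xs (λ x → f x ∘[X+ c ])
  ∘-∑ₚ c []       f = ≈-refl
  ∘-∑ₚ c (x ∷ xs) f = ≈-trans (∘-+ₚ c (f x) (∑ₚ xs f)) (+ₚ-cong ≈-refl (∘-∑ₚ c xs f))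

  module Stepanov {p m r : ℕ} (p-prime : Prime p) (p·1≡0 : p ·1 ≡ 0#) (m+r<p : m ℕ.+ r ℕ.< p)
                  {A B : List Carrier} (A-unique : Unique A) (B-unique : Unique B) (|A|≡1+r : length A ≡ suc r)
                  (sums-roots : ∀ {a b} → a ∈ A → b ∈ B → (a + b) ^ m ≡ 1#) where

    open Characteristic p-prime p·1≡0
    open ≡-Reasoning

    private
      N : ℕ
      N = m ℕ.+ r

      w : Carrier → Carrier
      w = proj₁ (interpolation-weights A A-unique |A|≡1+r)

      w-spec : ∀ P → DegreeBelow (suc r) P → ∑[ a ∈ A ] (w a * eval P a) ≡ coeff P r
      w-spec = proj₂ (interpolation-weights A A-unique |A|≡1+r)

    auxiliary : Poly
    auxiliary = ∑ₚ A (λ a → w a ·ₚ (X^ N ∘[X+ a ])) +ₚ const (- 1#)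

    weighted-power-sum : ∀ e → e ℕ.≤ r → ∑[ a ∈ A ] (w a * a ^ e) ≡ coeff (X^ e) r
    weighted-power-sum e e≤r = begin
      ∑[ a ∈ A ] (w a * a ^ e)         ≡⟨ ∑-cong A (λ {a} _ → cong (w a *_) (eval-X^ e a)) ⟨
      ∑[ a ∈ A ] (w a * eval (X^ e) a) ≡⟨ w-spec (X^ e) (DegreeBelow-mono (X^ e) (s≤s e≤r) (X^-degree e)) ⟩
      coeff (X^ e) r                   ∎

    weighted-shifted-power-sum : ∀ b e → e ℕ.≤ r → ∑[ a ∈ A ] (w a * (a + b) ^ e) ≡ (e C r) ·1 * b ^ (e ∸ r)
    weighted-shifted-power-sum b e e≤r = begin
      ∑[ a ∈ A ] (w a * (a + b) ^ e)                   ≡⟨ ∑-cong A (λ {a} _ → cong (w a *_) eval≡) ⟨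
      ∑[ a ∈ A ] (w a * eval (X^ e ∘[X+ b ]) a)
        ≡⟨ w-spec (X^ e ∘[X+ b ]) (∘-degree b (X^ e) (DegreeBelow-mono (X^ e) (s≤s e≤r) (X^-degree e))) ⟩
      coeff (X^ e ∘[X+ b ]) r                          ≡⟨ coeff-X^-∘ b e r ⟩
      (e C r) ·1 * b ^ (e ∸ r)                         ∎
      where
        eval≡ : ∀ {a} → eval (X^ e ∘[X+ b ]) a ≡ (a + b) ^ e
        eval≡ {a} = trans (eval-∘ (X^ e) b a) (trans (eval-X^ e (b + a)) (cong (_^ e) (+-comm b a)))

    private
      coeff-scaled-∑ₚ : ∀ (f : Carrier → Poly) k →
                        coeff (∑ₚ A (λ a → w a ·ₚ f a)) k ≡ ∑[ a ∈ A ] (w a * coeff (f a) k)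
      coeff-scaled-∑ₚ f k = trans (coeff-∑ₚ A (λ a → w a ·ₚ f a) k) (∑-cong A λ {a} _ → coeff-·ₚ (w a) (f a) k)

      factor-out : ∀ (x : Carrier) (f : Carrier → Carrier) → ∑[ a ∈ A ] (w a * (x * f a)) ≡ x * ∑[ a ∈ A ] (w a * f a)
      factor-out x f = trans (∑-cong A λ {a} _ → solve 3 (λ w x y → w :* (x :* y) := x :* (w :* y)) refl (w a) x (f a))
                             (∑-distribˡ-* A (λ a → w a * f a) x)

    coeff-auxiliary : ∀ {k} → 0 ℕ.< k → coeff auxiliary k ≡ (N C k) ·1 * ∑[ a ∈ A ] (w a * a ^ (N ∸ k))
    coeff-auxiliary {suc k} _ = begin
      coeff auxiliary (suc k)
        ≡⟨ trans (coeff-+ₚ (∑ₚ A (λ a → w a ·ₚ (X^ N ∘[X+ a ]))) (const (- 1#)) (suc k)) (+-identityʳ _) ⟩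
      coeff (∑ₚ A (λ a → w a ·ₚ (X^ N ∘[X+ a ]))) (suc k)
        ≡⟨ coeff-scaled-∑ₚ (λ a → X^ N ∘[X+ a ]) (suc k) ⟩
      ∑[ a ∈ A ] (w a * coeff (X^ N ∘[X+ a ]) (suc k))
        ≡⟨ ∑-cong A (λ {a} _ → cong (w a *_) (coeff-X^-∘ a N (suc k))) ⟩
      ∑[ a ∈ A ] (w a * ((N C suc k) ·1 * a ^ (N ∸ suc k)))
        ≡⟨ factor-out ((N C suc k) ·1) (_^ (N ∸ suc k)) ⟩
      (N C suc k) ·1 * ∑[ a ∈ A ] (w a * a ^ (N ∸ suc k)) ∎

    auxiliary-degree : DegreeBelow (suc m) auxiliary
    auxiliary-degree k 1+m≤k with N ℕ.<? k
    ... | yes N<k = begin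
      coeff auxiliary k                                ≡⟨ coeff-auxiliary 0<k ⟩
      (N C k) ·1 * ∑[ a ∈ A ] (w a * a ^ (N ∸ k))
        ≡⟨ cong (λ n → n ·1 * ∑[ a ∈ A ] (w a * a ^ (N ∸ k))) (k>n⇒nCk≡0 N<k) ⟩
      0# * ∑[ a ∈ A ] (w a * a ^ (N ∸ k))              ≡⟨ zeroˡ _ ⟩
      0#                                               ∎
      where 0<k = ℕ.≤-<-trans z≤n 1+m≤k
    ... | no  N≮k = begin
      coeff auxiliary k                                ≡⟨ coeff-auxiliary 0<k ⟩
      (N C k) ·1 * ∑[ a ∈ A ] (w a * a ^ (N ∸ k))      ≡⟨ cong ((N C k) ·1 *_) (weighted-power-sum (N ∸ k) (ℕ.<⇒≤ N∸k<r)) ⟩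
      (N C k) ·1 * coeff (X^ (N ∸ k)) r                ≡⟨ cong ((N C k) ·1 *_) (X^-degree (N ∸ k) r N∸k<r) ⟩
      (N C k) ·1 * 0#                                  ≡⟨ zeroʳ _ ⟩
      0#                                               ∎
      where
        0<k = ℕ.≤-<-trans z≤n 1+m≤k
        N∸k<r : N ∸ k ℕ.< r
        N∸k<r = exponent-drop 1+m≤k (ℕ.≮⇒≥ N≮k)

    auxiliary-nonzero : 0 ℕ.< m → Nonzero auxiliary
    auxiliary-nonzero 0<m = m , λ coeffₘ≡0 → C·1≢0 (ℕ.m≤m+n m r) m+r<p (begin
      (N C m) ·1                                       ≡⟨ *-identityʳ _ ⟨
      (N C m) ·1 * 1#                                  ≡⟨ cong ((N C m) ·1 *_) (coeff-X^-self r) ⟨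
      (N C m) ·1 * coeff (X^ r) r                      ≡⟨ cong (λ e → (N C m) ·1 * coeff (X^ e) r) (ℕ.m+n∸m≡n m r) ⟨
      (N C m) ·1 * coeff (X^ (N ∸ m)) r
        ≡⟨ cong ((N C m) ·1 *_) (weighted-power-sum (N ∸ m) (ℕ.≤-reflexive (ℕ.m+n∸m≡n m r))) ⟨
      (N C m) ·1 * ∑[ a ∈ A ] (w a * a ^ (N ∸ m))      ≡⟨ coeff-auxiliary 0<m ⟨
      coeff auxiliary m                                ≡⟨ coeffₘ≡0 ⟩
      0#                                               ∎)

    coeff-auxiliary-∘ : ∀ {b} j → b ∈ B → j ℕ.≤ r →
                        coeff (auxiliary ∘[X+ b ]) j
                          ≡ (N C j) ·1 * (((r ∸ j) C r) ·1 * b ^ ((r ∸ j) ∸ r)) + coeff (const (- 1#)) j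
    coeff-auxiliary-∘ {b} j b∈B j≤r = begin
      coeff (auxiliary ∘[X+ b ]) j
        ≡⟨ coeff-≈ (∘-+ₚ b (∑ₚ A (λ a → w a ·ₚ (X^ N ∘[X+ a ]))) (const (- 1#))) j ⟩
      coeff (∑ₚ A (λ a → w a ·ₚ (X^ N ∘[X+ a ])) ∘[X+ b ] +ₚ const (- 1#) ∘[X+ b ]) j
        ≡⟨ coeff-≈ (+ₚ-cong (∘-∑ₚ b A (λ a → w a ·ₚ (X^ N ∘[X+ a ]))) (∘-const b (- 1#))) j ⟩
      coeff (∑ₚ A (λ a → (w a ·ₚ (X^ N ∘[X+ a ])) ∘[X+ b ]) +ₚ const (- 1#)) j
        ≡⟨ coeff-+ₚ (∑ₚ A (λ a → (w a ·ₚ (X^ N ∘[X+ a ])) ∘[X+ b ])) (const (- 1#)) j ⟩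
      coeff (∑ₚ A (λ a → (w a ·ₚ (X^ N ∘[X+ a ])) ∘[X+ b ])) j + coeff (const (- 1#)) j
        ≡⟨ cong (_+ coeff (const (- 1#)) j) sum≡ ⟩
      (N C j) ·1 * (((r ∸ j) C r) ·1 * b ^ ((r ∸ j) ∸ r)) + coeff (const (- 1#)) j ∎
      where
        term : ∀ {a} → a ∈ A → coeff ((w a ·ₚ (X^ N ∘[X+ a ])) ∘[X+ b ]) j ≡ w a * ((N C j) ·1 * (a + b) ^ (r ∸ j))
        term {a} a∈A = begin
          coeff ((w a ·ₚ (X^ N ∘[X+ a ])) ∘[X+ b ]) j   ≡⟨ coeff-≈ (∘-·ₚ b (w a) (X^ N ∘[X+ a ])) j ⟩
          coeff (w a ·ₚ (X^ N ∘[X+ a ] ∘[X+ b ])) j     ≡⟨ coeff-·ₚ (w a) (X^ N ∘[X+ a ] ∘[X+ b ]) j ⟩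
          w a * coeff (X^ N ∘[X+ a ] ∘[X+ b ]) j        ≡⟨ cong (w a *_) (coeff-≈ (∘-∘ a b (X^ N)) j) ⟩
          w a * coeff (X^ N ∘[X+ a + b ]) j             ≡⟨ cong (w a *_) (coeff-X^-∘ (a + b) N j) ⟩
          w a * ((N C j) ·1 * (a + b) ^ (N ∸ j))        ≡⟨ cong (λ x → w a * ((N C j) ·1 * x)) power≡ ⟩
          w a * ((N C j) ·1 * (a + b) ^ (r ∸ j))        ∎
          where
            power≡ : (a + b) ^ (N ∸ j) ≡ (a + b) ^ (r ∸ j)
            power≡ = begin
              (a + b) ^ (N ∸ j)                     ≡⟨ cong ((a + b) ^_) (ℕ.+-∸-assoc m j≤r) ⟩
              (a + b) ^ (m ℕ.+ (r ∸ j))             ≡⟨ ^-distribˡ-+-* (a + b) m (r ∸ j) ⟩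
              (a + b) ^ m * (a + b) ^ (r ∸ j)       ≡⟨ cong (_* (a + b) ^ (r ∸ j)) (sums-roots a∈A b∈B) ⟩
              1# * (a + b) ^ (r ∸ j)                ≡⟨ *-identityˡ _ ⟩
              (a + b) ^ (r ∸ j)                     ∎
        sum≡ : coeff (∑ₚ A (λ a → (w a ·ₚ (X^ N ∘[X+ a ])) ∘[X+ b ])) j
               ≡ (N C j) ·1 * (((r ∸ j) C r) ·1 * b ^ ((r ∸ j) ∸ r))
        sum≡ = begin
          coeff (∑ₚ A (λ a → (w a ·ₚ (X^ N ∘[X+ a ])) ∘[X+ b ])) j
            ≡⟨ coeff-∑ₚ A (λ a → (w a ·ₚ (X^ N ∘[X+ a ])) ∘[X+ b ]) j ⟩
          ∑[ a ∈ A ] coeff ((w a ·ₚ (X^ N ∘[X+ a ])) ∘[X+ b ]) j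
            ≡⟨ ∑-cong A term ⟩
          ∑[ a ∈ A ] (w a * ((N C j) ·1 * (a + b) ^ (r ∸ j)))
            ≡⟨ factor-out ((N C j) ·1) (λ a → (a + b) ^ (r ∸ j)) ⟩
          (N C j) ·1 * ∑[ a ∈ A ] (w a * (a + b) ^ (r ∸ j))
            ≡⟨ cong ((N C j) ·1 *_) (weighted-shifted-power-sum b (r ∸ j) (ℕ.m∸n≤m r j)) ⟩
          (N C j) ·1 * (((r ∸ j) C r) ·1 * b ^ ((r ∸ j) ∸ r)) ∎

    auxiliary-roots : ∀ {b} → b ∈ B → VanishesBelow (suc r) (auxiliary ∘[X+ b ])
    auxiliary-roots {b} b∈B zero _ = begin
      coeff (auxiliary ∘[X+ b ]) 0                                 ≡⟨ coeff-auxiliary-∘ 0 b∈B z≤n ⟩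
      (N C 0) ·1 * ((r C r) ·1 * b ^ (r ∸ r)) + - 1#
        ≡⟨ cong₂ (λ n e → 1 ·1 * (n ·1 * b ^ e) + - 1#) (nCn≡1 r) (ℕ.n∸n≡0 r) ⟩
      1 ·1 * (1 ·1 * 1#) + - 1#                                    ≡⟨ cong (λ x → x * (x * 1#) + - 1#) (+-identityʳ 1#) ⟩
      1# * (1# * 1#) + - 1#                                        ≡⟨ cong (_+ - 1#) (trans (*-identityˡ _) (*-identityˡ 1#)) ⟩
      1# + - 1#                                                    ≡⟨ -‿inverseʳ 1# ⟩
      0#                                                           ∎
    auxiliary-roots {b} b∈B (suc j) (s≤s j<r) = begin
      coeff (auxiliary ∘[X+ b ]) (suc j)                            ≡⟨ coeff-auxiliary-∘ (suc j) b∈B j<r ⟩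
      (N C suc j) ·1 * (((r ∸ suc j) C r) ·1 * b ^ ((r ∸ suc j) ∸ r)) + 0#
        ≡⟨ cong (λ n → (N C suc j) ·1 * (n ·1 * b ^ ((r ∸ suc j) ∸ r)) + 0#)
                (k>n⇒nCk≡0 (ℕ.∸-monoʳ-< (s≤s z≤n) j<r)) ⟩
      (N C suc j) ·1 * (0# * b ^ ((r ∸ suc j) ∸ r)) + 0#
        ≡⟨ +-identityʳ _ ⟩
      (N C suc j) ·1 * (0# * b ^ ((r ∸ suc j) ∸ r))                 ≡⟨ cong ((N C suc j) ·1 *_) (zeroˡ _) ⟩
      (N C suc j) ·1 * 0#                                           ≡⟨ zeroʳ _ ⟩
      0#                                                            ∎

    stepanov-bound : 0 ℕ.< m → length A ℕ.* length B ℕ.≤ m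
    stepanov-bound 0<m = subst (λ n → n ℕ.* length B ℕ.≤ m) (sym |A|≡1+r)
      (root-count B auxiliary B-unique (auxiliary-nonzero 0<m) auxiliary-degree auxiliary-roots)

  module PowerResidues (d : ℕ) where

    InS? : ∀ s → Dec (InS d s)
    InS? s = Dec.map′ from to (any? (λ x → ¬? (x ≟ 0#) ×-dec ((x ^ d) ≟ s)) elements)
      where
        from : Any (λ x → x ≢ 0# × x ^ d ≡ s) elements → InS d s
        from any with find any
        ... | x , _ , x≢0 , xᵈ≡s = x , x≢0 , xᵈ≡s
        to : InS d s → Any (λ x → x ≢ 0# × x ^ d ≡ s) elements
        to (x , x≢0 , xᵈ≡s) = lose (elements-complete x) (x≢0 , xᵈ≡s)

    residues : List Carrier
    residues = filter InS? elements

    residues-unique : Unique residues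
    residues-unique = Unique.filter⁺ InS? elements-unique

    ∈-residues⁺ : ∀ {s} → InS d s → s ∈ residues
    ∈-residues⁺ {s} s∈Sᵈ = ∈-filter⁺ InS? (elements-complete s) s∈Sᵈ

    ∈-residues⁻ : ∀ {s} → s ∈ residues → InS d s
    ∈-residues⁻ s∈residues = proj₂ (∈-filter⁻ InS? {xs = elements} s∈residues)

    roots-of-Xᵈ-y≤d : 0 ℕ.< d → ∀ {y zs} → Unique zs → All (λ z → z ^ d ≡ y) zs → length zs ℕ.≤ d
    roots-of-Xᵈ-y≤d 0<d {y} {zs} zs-unique zsᵈ≡y =
      subst (ℕ._≤ d) (ℕ.*-identityˡ (length zs)) (root-count zs P zs-unique P≢0 P-degree P-roots)
      where
        P = X^ d +ₚ const (- y)
        coeff-P-pos : ∀ {k} → 0 ℕ.< k → coeff P k ≡ coeff (X^ d) k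
        coeff-P-pos {suc k} _ = trans (coeff-+ₚ (X^ d) (const (- y)) (suc k)) (+-identityʳ _)
        P≢0 : Nonzero P
        P≢0 = d , λ Pᵈ≡0 → 1≢0 (trans (sym (coeff-X^-self d)) (trans (sym (coeff-P-pos 0<d)) Pᵈ≡0))
        P-degree : DegreeBelow (suc d) P
        P-degree k d<k = trans (coeff-P-pos (ℕ.≤-<-trans z≤n d<k)) (X^-degree d k d<k)
        P-roots : ∀ {z} → z ∈ zs → VanishesBelow 1 (P ∘[X+ z ])
        P-roots {z} z∈zs zero _ = begin
          eval P z                          ≡⟨ eval-+ₚ (X^ d) (const (- y)) z ⟩
          eval (X^ d) z + eval (const (- y)) z ≡⟨ cong₂ _+_ (eval-X^ d z) (eval-const (- y) z) ⟩
          z ^ d + - y                       ≡⟨ cong (_+ - y) (All.lookup zsᵈ≡y z∈zs) ⟩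
          y + - y                           ≡⟨ -‿inverseʳ y ⟩
          0#                                ∎
          where open ≡-Reasoning
        P-roots z∈zs (suc k) (s≤s ())

    nonzeros≤d*residues : 0 ℕ.< d → size ∸ 1 ℕ.≤ d ℕ.* length residues
    nonzeros≤d*residues 0<d = subst (ℕ._≤ d ℕ.* length residues) length-nonzeros
      (Counting.length≤bound*length-image _≟_ (_^ d) (roots-of-Xᵈ-y≤d 0<d) residues (without-unique elements-unique)
         (λ x∈nonzeros → ∈-residues⁺ (_ , nonzeros-≢0 x∈nonzeros , refl)))

  -- (x + b₁)² - (x + b₂)² = (b₁ - b₂)(2x + b₁ + b₂)
  square-roots-midpoint : ∀ {x b₁ b₂} → b₁ ≢ b₂ → (x + b₁) ^ 2 ≡ 1# → (x + b₂) ^ 2 ≡ 1# →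
                          (x + x) + (b₁ + b₂) ≡ 0#
  square-roots-midpoint {x} {b₁} {b₂} b₁≢b₂ sq₁ sq₂ =
    [ (λ b₁-b₂≡0 → ⊥-elim (b₁≢b₂ (x-y≡0⇒x≡y b₁-b₂≡0))) , id ]′ (x*y≡0⇒x≡0⊎y≡0 (begin
      (b₁ + - b₂) * ((x + x) + (b₁ + b₂))
        ≡⟨ solve 3 (λ x b₁ b₂ → (b₁ :+ :- b₂) :* ((x :+ x) :+ (b₁ :+ b₂))
                            := (x :+ b₁) :* (x :+ b₁) :+ :- ((x :+ b₂) :* (x :+ b₂))) refl x b₁ b₂ ⟩
      (x + b₁) * (x + b₁) + - ((x + b₂) * (x + b₂))   ≡⟨ cong₂ (λ s t → s + - t) (square sq₁) (square sq₂) ⟩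
      1# + - 1#                                       ≡⟨ -‿inverseʳ 1# ⟩
      0#                                              ∎))
    where
      open ≡-Reasoning
      square : ∀ {u} → u ^ 2 ≡ 1# → u * u ≡ 1#
      square {u} u²≡1 = trans (cong (u *_) (sym (*-identityʳ u))) u²≡1

  -- Every x ∈ A is -(b₁ + b₂)/2, so A has a single element.
  no-2×2-sumset-of-square-roots : 1# + 1# ≢ 0# → ∀ {A B} → Unique A → Unique B → length A ≡ 2 → length B ≡ 2 →
                                  (∀ {a b} → a ∈ A → b ∈ B → (a + b) ^ 2 ≡ 1#) → ⊥
  no-2×2-sumset-of-square-roots 2≢0 {a₁ ∷ a₂ ∷ []} {b₁ ∷ b₂ ∷ []}
                                ((a₁≢a₂ ∷ []) ∷ _) ((b₁≢b₂ ∷ []) ∷ _) refl refl sq =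
    [ 2≢0 , (λ a₁-a₂≡0 → a₁≢a₂ (x-y≡0⇒x≡y a₁-a₂≡0)) ]′ (x*y≡0⇒x≡0⊎y≡0 (begin
      (1# + 1#) * (a₁ + - a₂)
        ≡⟨ trans (distribʳ _ 1# 1#) (cong₂ _+_ (*-identityˡ _) (*-identityˡ _)) ⟩
      (a₁ + - a₂) + (a₁ + - a₂)
        ≡⟨ solve 4 (λ a₁ a₂ b₁ b₂ → (a₁ :+ :- a₂) :+ (a₁ :+ :- a₂)
                                 := ((a₁ :+ a₁) :+ (b₁ :+ b₂)) :+ :- ((a₂ :+ a₂) :+ (b₁ :+ b₂))) refl a₁ a₂ b₁ b₂ ⟩
      ((a₁ + a₁) + (b₁ + b₂)) + - ((a₂ + a₂) + (b₁ + b₂))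
        ≡⟨ cong₂ (λ s t → s + - t) (square-roots-midpoint b₁≢b₂ (sq a₁∈ b₁∈) (sq a₁∈ b₂∈))
                                   (square-roots-midpoint b₁≢b₂ (sq a₂∈ b₁∈) (sq a₂∈ b₂∈)) ⟩
      0# + - 0#                                       ≡⟨ -‿inverseʳ 0# ⟩
      0#                                              ∎))
    where
      open ≡-Reasoning
      a₁∈ = here refl
      a₂∈ = there (here refl)
      b₁∈ = here refl
      b₂∈ = there (here refl)

  module Sumset {p d m : ℕ} (p-prime : Prime p) (p·1≡0 : p ·1 ≡ 0#) (1<d : 1 ℕ.< d)
                (q-1≡md : size ∸ 1 ≡ m ℕ.* d) (3m≤2p : 3 ℕ.* m ℕ.≤ 2 ℕ.* p) where

    open PowerResidues d
    open Characteristic p-prime p·1≡0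

    residue^m≡1 : ∀ {s} → InS d s → s ^ m ≡ 1#
    residue^m≡1 (y , y≢0 , refl) = begin
      (y ^ d) ^ m       ≡⟨ ^-*-assoc y d m ⟩
      y ^ (d ℕ.* m)     ≡⟨ cong (y ^_) (trans (ℕ.*-comm d m) (sym q-1≡md)) ⟩
      y ^ (size ∸ 1)    ≡⟨ fermat y≢0 ⟩
      1#                ∎
      where open ≡-Reasoning

    m≤|residues| : m ℕ.≤ length residues
    m≤|residues| = ℕ.*-cancelˡ-≤ d {{ℕ.>-nonZero 0<d}}
      (subst (ℕ._≤ d ℕ.* length residues) (trans q-1≡md (ℕ.*-comm m d)) (nonzeros≤d*residues 0<d))
      where 0<d = ℕ.<-trans (s≤s z≤n) 1<d

    0<m : 0 ℕ.< m
    0<m = ℕ.n≢0⇒n>0 λ { refl → ℕ.<⇒≢ (ℕ.m<n⇒0<n∸m 2≤size) (sym q-1≡md) }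

    m<p : m ℕ.< p
    m<p = ℕ.≰⇒> λ p≤m → ℕ.<-irrefl refl (begin-strict
      3 ℕ.* m   ≤⟨ 3m≤2p ⟩
      2 ℕ.* p   ≤⟨ ℕ.*-monoʳ-≤ 2 p≤m ⟩
      2 ℕ.* m   <⟨ ℕ.*-monoˡ-< m {{ℕ.>-nonZero 0<m}} (ℕ.n<1+n 2) ⟩
      3 ℕ.* m   ∎)
      where open ℕ.≤-Reasoning

    private
      fits-below-p : ∀ {r} → suc r ℕ.≤ p ∸ m → m ℕ.+ r ℕ.< p
      fits-below-p {r} 1+r≤p-m = begin-strict
        m ℕ.+ r          <⟨ ℕ.+-monoʳ-< m (ℕ.n<1+n r) ⟩
        m ℕ.+ suc r      ≤⟨ ℕ.+-monoʳ-≤ m 1+r≤p-m ⟩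
        m ℕ.+ (p ∸ m)    ≡⟨ ℕ.m+[n∸m]≡n (ℕ.<⇒≤ m<p) ⟩
        p                ∎
        where open ℕ.≤-Reasoning

      2≢0 : p ≡ 3 → 1# + 1# ≢ 0#
      2≢0 refl 1+1≡0 = ·1≢0 {2} (s≤s z≤n) (ℕ.n<1+n 2) (trans (cong (1# +_) (+-identityʳ 1#)) 1+1≡0)

    -- When |A| > p - m only a (p - m)-element part of A is within the reach of Stepanov's method,
    -- which already forces p = 3, m = 2 and |A| = |B| = 2.
    roots-of-unity-sumset-bound : ∀ {A B} → Unique A → Unique B → length A ℕ.≤ length B →
                                  (∀ {a b} → a ∈ A → b ∈ B → (a + b) ^ m ≡ 1#) → length A ℕ.* length B ℕ.≤ m
    roots-of-unity-sumset-bound {[]} _ _ _ _ = z≤n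
    roots-of-unity-sumset-bound {A@(_ ∷ A′)} {B} A-unique B-unique |A|≤|B| sums with length A ℕ.≤? p ∸ m
    ... | yes |A|≤p-m = Stepanov.stepanov-bound p-prime p·1≡0 (fits-below-p |A|≤p-m) A-unique B-unique refl sums 0<m
    ... | no  |A|≰p-m with exceptional-sizes 3m≤2p m<p (ℕ.≰⇒> |A|≰p-m) |A|≤|B| part-bound
      where
        u = p ∸ m
        u≡1+pred[u] : u ≡ suc (ℕ.pred u)
        u≡1+pred[u] = sym (ℕ.suc-pred u {{ℕ.>-nonZero (ℕ.m<n⇒0<n∸m m<p)}})
        |take-u-A|≡u : length (take u A) ≡ u
        |take-u-A|≡u = trans (length-take u A) (ℕ.m≤n⇒m⊓n≡m (ℕ.<⇒≤ (ℕ.≰⇒> |A|≰p-m)))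
        part-bound : u ℕ.* length B ℕ.≤ m
        part-bound = subst (λ k → k ℕ.* length B ℕ.≤ m) |take-u-A|≡u
          (Stepanov.stepanov-bound p-prime p·1≡0 (fits-below-p (ℕ.≤-reflexive (sym u≡1+pred[u])))
             (Unique.take⁺ u A-unique) B-unique (trans |take-u-A|≡u u≡1+pred[u])
             (λ a∈ b∈ → sums (Any-resp-⊆ (take-⊆ (setoid Carrier) u A) a∈) b∈) 0<m)
    ... | p≡3 , m≡2 , |A|≡2 , |B|≡2 =
      ⊥-elim (no-2×2-sumset-of-square-roots (2≢0 p≡3) A-unique B-unique |A|≡2 |B|≡2
                (λ a∈A b∈B → subst (λ k → (_ + _) ^ k ≡ 1#) m≡2 (sums a∈A b∈B)))

    sumset-bound : ∀ A B → Unique A → Unique B → SumsetSub A B d → length A ℕ.* length B ℕ.≤ m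
    sumset-bound A B A-unique B-unique A+B⊆Sᵈ with length A ℕ.≤? length B
    ... | yes |A|≤|B| =
      roots-of-unity-sumset-bound A-unique B-unique |A|≤|B| (λ a∈A b∈B → residue^m≡1 (A+B⊆Sᵈ a∈A b∈B))
    ... | no  |A|≰|B| = subst (ℕ._≤ m) (ℕ.*-comm (length B) (length A))
      (roots-of-unity-sumset-bound B-unique A-unique (ℕ.<⇒≤ (ℕ.≰⇒> |A|≰|B|))
         (λ {b} {a} b∈B a∈A → subst (λ s → s ^ m ≡ 1#) (+-comm a b) (residue^m≡1 (A+B⊆Sᵈ a∈A b∈B))))

    sumset-equality : ∀ A B → Unique A → Unique B → SumsetEq A B d →
                      length A ℕ.* length B ≡ m ×
                      (∀ {a a′ b b′} → a ∈ A → a′ ∈ A → b ∈ B → b′ ∈ B → a + b ≡ a′ + b′ → a ≡ a′ × b ≡ b′)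
    sumset-equality A B A-unique B-unique (A+B⊆Sᵈ , Sᵈ⊆A+B) = |A||B|≡m , sums-distinct
      where
        open ℕ.≤-Reasoning
        pairs : List (Carrier × Carrier)
        pairs = cartesianProduct A B
        residues⊆sums : ∀ {s} → s ∈ residues → s ∈ map (uncurry _+_) pairs
        residues⊆sums {s} s∈residues with Sᵈ⊆A+B s (∈-residues⁻ s∈residues)
        ... | a , b , a∈A , b∈B , a+b≡s =
          subst (_∈ map (uncurry _+_) pairs) a+b≡s (∈-map⁺ (uncurry _+_) (∈-cartesianProduct⁺ a∈A b∈B))
        |pairs|≡|A||B| : length pairs ≡ length A ℕ.* length B
        |pairs|≡|A||B| = Counting.length-cartesianProduct A B
        |A||B|≡m : length A ℕ.* length B ≡ m
        |A||B|≡m = ℕ.≤-antisym (sumset-bound A B A-unique B-unique A+B⊆Sᵈ) (begin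
          m                                 ≤⟨ m≤|residues| ⟩
          length residues                   ≤⟨ Counting.DecEq.length-mono-⊆ _≟_ residues-unique residues⊆sums ⟩
          length (map (uncurry _+_) pairs)  ≡⟨ length-map (uncurry _+_) pairs ⟩
          length pairs                      ≡⟨ |pairs|≡|A||B| ⟩
          length A ℕ.* length B             ∎)
        sums-distinct : ∀ {a a′ b b′} → a ∈ A → a′ ∈ A → b ∈ B → b′ ∈ B → a + b ≡ a′ + b′ → a ≡ a′ × b ≡ b′
        sums-distinct {a} {a′} {b} {b′} a∈A a′∈A b∈B b′∈B a+b≡a′+b′ with ×-≡-dec _≟_ _≟_ (a , b) (a′ , b′)
        ... | yes refl       = refl , refl
        ... | no  ab≢a′b′ = ⊥-elim (ℕ.<-irrefl refl (begin-strict
          m                       ≤⟨ m≤|residues| ⟩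
          length residues         <⟨ Counting.length-<-of-collision (×-≡-dec _≟_ _≟_) _≟_ (uncurry _+_) residues-unique
                                       residues⊆sums (∈-cartesianProduct⁺ a∈A b∈B) (∈-cartesianProduct⁺ a′∈A b′∈B)
                                       ab≢a′b′ a+b≡a′+b′ ⟩
          length pairs            ≡⟨ |pairs|≡|A||B| ⟩
          length A ℕ.* length B   ≡⟨ |A||B|≡m ⟩
          m                       ∎))

    no-nontrivial-sumset : Prime m →
                           ¬ (∃ λ A → ∃ λ B → Unique A × Unique B × 2 ℕ.≤ length A × 2 ℕ.≤ length B × SumsetEq A B d)
    no-nontrivial-sumset m-prime (A , B , A-unique , B-unique , 2≤|A| , 2≤|B| , A+B≡Sᵈ) =
      ¬prime-product 2≤|A| 2≤|B| (subst Prime (sym (proj₁ (sumset-equality A B A-unique B-unique A+B≡Sᵈ))) m-prime)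

open FiniteField using (Carrier; size; 0#; _·1; SumsetSub; SumsetEq) renaming (_+_ to add)
open import Data.Nat using (_*_; _^_; _≤_; _<_)

corollary1p2 : (F : FiniteField) →
    (p k d m : ℕ) → Prime p → _·1 F p ≡ 0# F → size F ≡ p ^ k →
    1 < d → size F ∸ 1 ≡ m * d → 3 * m ≤ 2 * p →
    ((A B : List (Carrier F)) → Unique A → Unique B →
       SumsetSub F A B d → length A * length B ≤ m)
    × ((A B : List (Carrier F)) → Unique A → Unique B →
       SumsetEq F A B d →
         (length A * length B ≡ m)
         × (∀ {a a′ b b′} → a ∈ A → a′ ∈ A → b ∈ B → b′ ∈ B →
              add F a b ≡ add F a′ b′ → a ≡ a′ × b ≡ b′))
    × (Prime m → ¬ (∃ λ (A : List (Carrier F)) → ∃ λ (B : List (Carrier F)) →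
         Unique A × Unique B × 2 ≤ length A × 2 ≤ length B × SumsetEq F A B d))
corollary1p2 F p k d m p-prime p·1≡0 _ 1<d q-1≡md 3m≤2p = sumset-bound , sumset-equality , no-nontrivial-sumset
  where open FieldTheory.Sumset F {m = m} p-prime p·1≡0 1<d q-1≡md 3m≤2p
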